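{- Let $(G,w)$ be a vertex-weighted graph with $n$ vertices and total weight $d$. Then $\overline{X}_{(G,w)}=(-1)^{d-n}\omega(X_{(G,w)})$ is $p$-positive, i.e. its expansion in the power-sum basis $\{p_\lambda\}$ has all coefficients nonnegative.
   Context: A graph $G$ is finite with vertex set $V(G)$ and edge multiset $E(G)$ of pairs of not necessarily distinct vertices (loops and multi-edges allowed). A vertex-weighted graph $(G,w)$ has $w:V(G)\to\mathbb{Z}^+$; its total weight is $\sum_v w(v)$. A coloring $\kappa:V(G)\to\mathbb{Z}^+$ is proper if $\kappa(v_1)\ne\kappa(v_2)$ whenever some edge has endpoints $v_1,v_2$; $X_{(G,w)}=\sum_{\kappa}\prod_{v}x_{\kappa(v)}^{w(v)}$ over proper colorings. An orientation orders the endpoints of each edge (tail $\to$ head; a loop at $v$ is $v\to v$); it is acyclic if no cycle of $G$ (including loops and 2-cycles formed by parallel edges) has all edges oriented consistently around it. A coloring $\kappa$ is weakly proper with respect to an acyclic orientation $\gamma$ if $\kappa(v_1)\le\kappa(v_2)$ for every edge oriented $v_1\to v_2$. $\overline{X}_{(G,w)}=\sum_{(\gamma,\kappa)}\prod_{v}x_{\kappa(v)}^{w(v)}$ over pairs with $\gamma$ acyclic and $\kappa$ weakly proper with respect to $\gamma$. $\omega$ is the involution on symmetric functions with $\omega(p_\lambda)=(-1)^{|\lambda|-l(\lambda)}p_\lambda$, where $p_\lambda$ are power-sum symmetric functions. -}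

module Defs where

open import Data.Nat as ℕ using (ℕ; zero; suc)
open import Data.Bool using (Bool; true; false; if_then_else_)
open import Data.Fin as Fin using (Fin; toℕ)
open import Data.Fin.Properties as FinP using ()
open import Data.List as List using (List; []; _∷_; length; allFin; map; filter)
open import Data.Nat.ListAction using (sum)
open import Data.List.Relation.Unary.All using (All; all?)
open import Data.List.Relation.Unary.Linked using (Linked)
open import Data.List.Relation.Unary.Unique.Propositional using (Unique)
open import Data.List.Membership.Propositional using (_∈_)
open import Data.Vec as Vec using (Vec; []; _∷_; lookup; tabulate)
open import Data.Vec.Properties as VecP using ()
open import Data.Product using (Σ; ∃; _×_; _,_; proj₁; proj₂)
open import Data.Integer as ℤ using (ℤ; +_)
open import Data.Rational as ℚ using (ℚ; 0ℚ; 1ℚ; _/_)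
open import Function.Bundles using (_⇔_)
open import Relation.Nullary using (¬_; Dec; ¬?)
open import Relation.Nullary.Decidable using (⌊_⌋; _×-dec_)
open import Relation.Unary using (Decidable)
open import Relation.Binary.PropositionalEquality using (_≡_; _≢_)

allVec : (k n : ℕ) → List (Vec (Fin k) n)
allVec k zero    = [] ∷ []
allVec k (suc n) = List.concatMap (λ x → map (x ∷_) (allVec k n)) (allFin k)

count : {A : Set} {P : A → Set} → Decidable P → List A → ℕ
count P? xs = length (filter P? xs)

CountIs : {A : Set} → (A → Set) → ℕ → Set
CountIs {A} P m = Σ (List A) λ l → Unique l × (∀ x → (x ∈ l) ⇔ P x) × length l ≡ m

ℕtoℚ : ℕ → ℚ
ℕtoℚ m = (+ m) / 1

signℚ : ℕ → ℚ
signℚ zero          = 1ℚ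
signℚ (suc zero)    = ℚ.- 1ℚ
signℚ (suc (suc e)) = signℚ e

-- Graphs: vertex set Fin n, edge multiset = list of (unordered) pairs of
-- not necessarily distinct vertices (loops and multi-edges allowed).

record Graph (n : ℕ) : Set where
  field
    edges : List (Fin n × Fin n)
open Graph public

nEdges : ∀ {n} → Graph n → ℕ
nEdges G = length (edges G)

edge : ∀ {n} (G : Graph n) → Fin (nEdges G) → Fin n × Fin n
edge G i = List.lookup (edges G) i

PositiveWeight : ∀ {n} → (Fin n → ℕ) → Set
PositiveWeight {n} w = ∀ (v : Fin n) → 1 ℕ.≤ w v

totalWeight : ∀ {n} → (Fin n → ℕ) → ℕ
totalWeight {n} w = sum (map w (allFin n))

-- A monomial x₁^{α₁} ⋯ x_k^{α_k} (all other exponents 0) is given by α : Vec ℕ k.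
-- A colouring that contributes to this monomial (all weights being positive)
-- uses only colours 1..k, represented by Fin k; κ : Vec (Fin k) n.

-- exponent of x_i in ∏_v x_{κ(v)}^{w(v)}
classWeight : ∀ {n k} → Vec (Fin k) n → (Fin n → ℕ) → Fin k → ℕ
classWeight {n} κ w i =
  sum (map (λ v → if ⌊ lookup κ v Fin.≟ i ⌋ then w v else 0) (allFin n))

HasMonomial : ∀ {n k} → (Fin n → ℕ) → Vec ℕ k → Vec (Fin k) n → Set
HasMonomial w α κ = tabulate (classWeight κ w) ≡ α

hasMonomial? : ∀ {n k} (w : Fin n → ℕ) (α : Vec ℕ k) → Decidable (HasMonomial w α)
hasMonomial? w α κ = VecP.≡-dec ℕ._≟_ (tabulate (classWeight κ w)) α

Proper : ∀ {n k} → Graph n → Vec (Fin k) n → Set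
Proper G κ = All (λ e → lookup κ (proj₁ e) ≢ lookup κ (proj₂ e)) (edges G)

proper? : ∀ {n k} (G : Graph n) → Decidable (Proper {k = k} G)
proper? G κ = all? (λ e → ¬? (lookup κ (proj₁ e) Fin.≟ lookup κ (proj₂ e))) (edges G)

ProperWithMonomial : ∀ {n k} → Graph n → (Fin n → ℕ) → Vec ℕ k → Vec (Fin k) n → Set
ProperWithMonomial G w α κ = Proper G κ × HasMonomial w α κ

-- coefficient of x^α in X_{(G,w)}
Xcoef : ∀ {n k} → Graph n → (Fin n → ℕ) → Vec ℕ k → ℕ
Xcoef {n} {k} G w α =
  count (λ κ → proper? G κ ×-dec hasMonomial? w α κ) (allVec k n)

-- Orientations: for each edge e = (a , b), true means a → b, false means b → a.
-- (For a loop both choices give v → v; such orientations are never acyclic.)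

Orientation : ∀ {n} → Graph n → Set
Orientation G = Vec Bool (nEdges G)

orient : ∀ {n} → Fin n × Fin n → Bool → Fin n × Fin n
orient (a , b) true  = (a , b)
orient (a , b) false = (b , a)

arc : ∀ {n} (G : Graph n) → Orientation G → Fin (nEdges G) → Fin n × Fin n
arc G γ i = orient (edge G i) (lookup γ i)

Arc : ∀ {n} (G : Graph n) → Orientation G → Fin n → Fin n → Set
Arc G γ u v = ∃ λ i → arc G γ i ≡ (u , v)

data Walk⁺ {n} (G : Graph n) (γ : Orientation G) : Fin n → Fin n → Set where
  step : ∀ {u v} → Arc G γ u v → Walk⁺ G γ u v
  _∷_  : ∀ {u x v} → Arc G γ u x → Walk⁺ G γ x v → Walk⁺ G γ u v

-- acyclic: no consistently oriented cycle, i.e. no closed directed walk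
-- (loops and 2-cycles from parallel edges included)
Acyclic : ∀ {n} (G : Graph n) → Orientation G → Set
Acyclic {n} G γ = ∀ (v : Fin n) → ¬ Walk⁺ G γ v v

WeaklyProper : ∀ {n k} (G : Graph n) → Orientation G → Vec (Fin k) n → Set
WeaklyProper G γ κ =
  ∀ i → toℕ (lookup κ (proj₁ (arc G γ i))) ℕ.≤ toℕ (lookup κ (proj₂ (arc G γ i)))

-- pairs (γ , κ) contributing to the coefficient of x^α in X̄_{(G,w)}
XbarPair : ∀ {n k} → (G : Graph n) → (Fin n → ℕ) → Vec ℕ k → Orientation G × Vec (Fin k) n → Set
XbarPair G w α (γ , κ) = Acyclic G γ × WeaklyProper G γ κ × HasMonomial w α κ

IsPartition : List ℕ → Set
IsPartition λs = All (λ p → 1 ℕ.≤ p) λs × Linked (λ a b → b ℕ.≤ a) λs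

-- coefficient of x^α in p_λ = ∏_j (∑_i x_i^{λ_j}):
-- number of f : parts → colours with ∑_{f(j) = i} λ_j = α_i
pcoef : ∀ {k} → List ℕ → Vec ℕ k → ℕ
pcoef {k} λs α =
  count (hasMonomial? (List.lookup λs) α) (allVec k (length λs))

-- a finite ℚ-linear combination ∑ c_λ p_λ of power sums
PExpansion : Set
PExpansion = List (List ℕ × ℚ)

ValidPExpansion : PExpansion → Set
ValidPExpansion L = All (λ t → IsPartition (proj₁ t)) L

evalCoef : ∀ {k} → PExpansion → Vec ℕ k → ℚ
evalCoef []              α = 0ℚ
evalCoef ((λs , c) ∷ L) α = (c ℚ.* ℕtoℚ (pcoef λs α)) ℚ.+ evalCoef L α

-- ω(p_λ) = (-1)^{|λ| - l(λ)} p_λ, extended linearly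
ωExp : PExpansion → PExpansion
ωExp = map (λ t → (proj₁ t , signℚ (sum (proj₁ t) ℕ.∸ length (proj₁ t)) ℚ.* proj₂ t))

scaleExp : ℚ → PExpansion → PExpansion
scaleExp s = map (λ t → (proj₁ t , s ℚ.* proj₂ t))

PPositive : PExpansion → Set
PPositive L = All (λ t → 0ℚ ℚ.≤ proj₂ t) L

-- Deletion–contraction on the edge list, for a fixed monomial x^α.  For edges E still to be
-- processed and edges C already contracted, let P(E,C) count the proper colourings of E that
-- are constant on the classes of C, and B(E,C) the pairs (γ , κ) with κ constant on C and γ an
-- orientation of E that, together with the undirected links C, has no consistently oriented
-- cycle and is weakly respected by κ.  If the ends of e = ab lie in different classes, then
--   P(E,C) = P(ab∷E,C) + P(E,ab∷C)   and   B(ab∷E,C) = B(E,C) + B(E,ab∷C),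
-- the second because an acyclic orientation cannot have both a ⇝ b and b ⇝ a; if they lie in
-- the same class, both P(ab∷E,C) and B(ab∷E,C) vanish.  At E = [] what remains are the colourings
-- of the quotient by a final contraction C′, counted by the coefficient of p_λ(C′) where λ(C′)
-- lists the class weights.  Each contraction removes one class, so
--   X = Σ (−1)^(n − l(λ(C′))) p_λ(C′)   and   X̄ = Σ p_λ(C′),
-- and as ω p_λ = (−1)^(d − l(λ)) p_λ, the operator (−1)^(d−n) ω sends each term of the first sum
-- to the corresponding term of the second: every coefficient becomes 1.

module Submission where

open import Defs
open import Data.Nat using (ℕ)
open import Data.Fin using (Fin)
open import Data.Vec using (Vec)
open import Data.Product using (Σ; _×_)
open import Data.Rational using (ℚ)
open import Relation.Binary.PropositionalEquality using (_≡_)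

open import Data.Nat as ℕ using (zero; suc; _+_; _*_; _∸_; _≤_; _<_)
import Data.Nat.Properties as ℕₚ
open import Data.Nat.ListAction using (sum)
open import Data.Nat.ListAction.Properties using (sum-++; sum-↭)
open import Algebra.Properties.CommutativeSemigroup ℕₚ.+-commutativeSemigroup using (interchange; xy∙z≈xz∙y)
import Data.Integer as ℤ
import Data.Integer.Properties as ℤₚ
open import Data.Integer.Solver using () renaming (module +-*-Solver to ℤ-Solver)
open import Data.Rational as ℚ using (0ℚ; 1ℚ)
import Data.Rational.Properties as ℚₚ
import Data.Rational.Unnormalised as ℚᵘ
import Data.Rational.Unnormalised.Properties as ℚᵘₚ
open import Data.Rational.Solver using (module +-*-Solver)
open import Algebra.Properties.Group ℚₚ.+-0-group using (⁻¹-involutive)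
open import Data.Bool using (Bool; true; false; if_then_else_)
open import Data.Empty using (⊥; ⊥-elim)
open import Data.Fin as Fin using (toℕ; punchIn; punchOut)
import Data.Fin.Properties as Finₚ
open import Data.Vec using ([]; _∷_; lookup; tabulate)
import Data.Vec.Properties as Vecₚ
open import Data.List as List using (List; []; _∷_; _++_; map; filter; length; concatMap; allFin; cartesianProduct)
import Data.List.Properties as Listₚ
open import Data.List.Membership.Propositional using (_∈_)
open import Data.List.Membership.Propositional.Properties
  using (∈-map⁺; ∈-map⁻; ∈-filter⁺; ∈-filter⁻; ∈-concatMap⁺; ∈-allFin; ∈-cartesianProduct⁺)
open import Data.List.Membership.Propositional.Properties.WithK using (unique∧set⇒bag)
import Data.List.Membership.DecPropositional as DecMembership
open import Data.List.Relation.Binary.BagAndSetEquality using (∼bag⇒↭)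
open import Data.List.Relation.Binary.Disjoint.Propositional using (Disjoint)
import Data.List.Relation.Binary.Permutation.Propositional as ↭
open ↭ using (_↭_; ↭-sym)
open import Data.List.Relation.Binary.Permutation.Propositional.Properties using (↭-length; All-resp-↭)
open import Data.List.Relation.Unary.Any as Any using (here; there)
open import Data.List.Relation.Unary.All as All using (All; []; _∷_)
import Data.List.Relation.Unary.All.Properties as Allₚ
open import Data.List.Relation.Unary.AllPairs as AllPairs using ([]; _∷_)
import Data.List.Relation.Unary.AllPairs.Properties as AllPairsₚ
open import Data.List.Relation.Unary.Unique.Propositional using (Unique)
import Data.List.Relation.Unary.Unique.Propositional.Properties as Uniqueₚ
import Data.List.Sort as Sort
open Data.Product using (∃; ∃₂; _,_; proj₁; proj₂)
import Data.Product.Properties as Productₚ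
open import Data.Sum using (_⊎_; inj₁; inj₂; [_,_]; swap)
open import Relation.Nullary using (¬_; Dec; yes; no; ¬?)
open import Relation.Nullary.Decidable using (⌊_⌋; _×-dec_; _⊎-dec_; map′; dec-true; isYes≗does)
open import Relation.Nullary.Negation using (_¬-⊎_)
open import Relation.Unary using (Decidable)
open Relation.Binary.PropositionalEquality using (_≢_; refl; sym; trans; cong; cong₂; subst; module ≡-Reasoning)
open import Relation.Binary.Definitions using (DecidableEquality; Tri; tri<; tri≈; tri>)
import Relation.Binary.Properties.DecTotalOrder as DecTotalOrderₚ
open import Relation.Binary.Construct.Closure.ReflexiveTransitive using (Star; ε; _◅_; _◅◅_; gmap)
open import Function using (_∘_; id)
open import Function.Bundles using (_⇔_; mk⇔; Equivalence)

-- Finite sums and counting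

∑ : {A : Set} → List A → (A → ℕ) → ℕ
∑ xs f = sum (map f xs)

module _ {A : Set} where

  ∑-cong : ∀ (xs : List A) {f g : A → ℕ} → (∀ x → f x ≡ g x) → ∑ xs f ≡ ∑ xs g
  ∑-cong []       f≗g = refl
  ∑-cong (x ∷ xs) f≗g = cong₂ _+_ (f≗g x) (∑-cong xs f≗g)

  ∑-zero : ∀ (xs : List A) → ∑ xs (λ _ → 0) ≡ 0
  ∑-zero []       = refl
  ∑-zero (x ∷ xs) = ∑-zero xs

  ∑-one : ∀ (xs : List A) → ∑ xs (λ _ → 1) ≡ length xs
  ∑-one []       = refl
  ∑-one (x ∷ xs) = cong suc (∑-one xs)

  ∑-+ : ∀ (xs : List A) (f g : A → ℕ) → ∑ xs (λ x → f x + g x) ≡ ∑ xs f + ∑ xs g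
  ∑-+ []       f g = refl
  ∑-+ (x ∷ xs) f g = trans (cong (f x + g x +_) (∑-+ xs f g)) (interchange (f x) (g x) (∑ xs f) (∑ xs g))

  ∑-*ˡ : ∀ (xs : List A) (c : ℕ) (f : A → ℕ) → ∑ xs (λ x → c * f x) ≡ c * ∑ xs f
  ∑-*ˡ []       c f = sym (ℕₚ.*-zeroʳ c)
  ∑-*ˡ (x ∷ xs) c f = trans (cong (c * f x +_) (∑-*ˡ xs c f)) (sym (ℕₚ.*-distribˡ-+ c (f x) (∑ xs f)))

  ∑-mono-≤ : ∀ (xs : List A) {f g : A → ℕ} → (∀ x → f x ≤ g x) → ∑ xs f ≤ ∑ xs g
  ∑-mono-≤ []       f≤g = ℕ.z≤n
  ∑-mono-≤ (x ∷ xs) f≤g = ℕₚ.+-mono-≤ (f≤g x) (∑-mono-≤ xs f≤g)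

  ∑-++ : ∀ (xs ys : List A) (f : A → ℕ) → ∑ (xs ++ ys) f ≡ ∑ xs f + ∑ ys f
  ∑-++ xs ys f = trans (cong sum (Listₚ.map-++ f xs ys)) (sum-++ (map f xs) (map f ys))

  term≤∑ : ∀ {x : A} {xs} (f : A → ℕ) → x ∈ xs → f x ≤ ∑ xs f
  term≤∑ f (here refl) = ℕₚ.m≤m+n _ _
  term≤∑ {xs = y ∷ _} f (there x∈xs) = ℕₚ.≤-trans (term≤∑ f x∈xs) (ℕₚ.m≤n+m _ (f y))

∑-map : ∀ {A B : Set} (h : A → B) (xs : List A) (f : B → ℕ) → ∑ (map h xs) f ≡ ∑ xs (f ∘ h)
∑-map h xs f = cong sum (sym (Listₚ.map-∘ xs))

module _ {A B : Set} where

  ∑-concatMap : ∀ (h : A → List B) (xs : List A) (f : B → ℕ) →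
    ∑ (concatMap h xs) f ≡ ∑ xs (λ x → ∑ (h x) f)
  ∑-concatMap h []       f = refl
  ∑-concatMap h (x ∷ xs) f = trans (∑-++ (h x) (concatMap h xs) f) (cong (∑ (h x) f +_) (∑-concatMap h xs f))

  ∑-comm : ∀ (xs : List A) (ys : List B) (f : A → B → ℕ) →
    ∑ xs (λ x → ∑ ys (f x)) ≡ ∑ ys (λ y → ∑ xs (λ x → f x y))
  ∑-comm []       ys f = sym (∑-zero ys)
  ∑-comm (x ∷ xs) ys f =
    trans (cong (∑ ys (f x) +_) (∑-comm xs ys f)) (sym (∑-+ ys (f x) (λ y → ∑ xs (λ x′ → f x′ y))))

  ∑-cartesianProduct : ∀ (xs : List A) (ys : List B) (f : A × B → ℕ) →
    ∑ (cartesianProduct xs ys) f ≡ ∑ xs (λ x → ∑ ys (λ y → f (x , y)))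
  ∑-cartesianProduct []       ys f = refl
  ∑-cartesianProduct (x ∷ xs) ys f =
    trans (∑-++ (map (x ,_) ys) (cartesianProduct xs ys) f)
          (cong₂ _+_ (∑-map (x ,_) ys f) (∑-cartesianProduct xs ys f))

∑-allFin-suc : ∀ {n} (f : Fin (suc n) → ℕ) → ∑ (allFin (suc n)) f ≡ f Fin.zero + ∑ (allFin n) (f ∘ Fin.suc)
∑-allFin-suc f =
  cong (f Fin.zero +_) (cong sum (trans (Listₚ.map-tabulate Fin.suc f) (sym (Listₚ.map-tabulate id (f ∘ Fin.suc)))))

∑-indicator : ∀ {m} (x : Fin m) (h : Fin m → ℕ) → ∑ (allFin m) (λ j → if ⌊ x Fin.≟ j ⌋ then h j else 0) ≡ h x
∑-indicator {suc m} Fin.zero    h = trans (∑-allFin-suc (λ j → if ⌊ Fin.zero Fin.≟ j ⌋ then h j else 0))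
                                            (trans (cong (h Fin.zero +_) (∑-zero (allFin m))) (ℕₚ.+-identityʳ (h Fin.zero)))
∑-indicator {suc m} (Fin.suc x) h = trans (∑-allFin-suc (λ j → if ⌊ Fin.suc x Fin.≟ j ⌋ then h j else 0))
  (trans (∑-cong (allFin m) (λ j → cong (λ b → if b then h (Fin.suc j) else 0) (≟-suc x j))) (∑-indicator x (h ∘ Fin.suc)))
  where
  ≟-suc : ∀ {m} (x j : Fin m) → ⌊ Fin.suc x Fin.≟ Fin.suc j ⌋ ≡ ⌊ x Fin.≟ j ⌋
  ≟-suc x j with x Fin.≟ j
  ... | yes _ = refl
  ... | no _  = refl

𝟙 : {P : Set} → Dec P → ℕ
𝟙 (yes _) = 1
𝟙 (no _)  = 0

module _ {P Q : Set} where

  𝟙-cong : (p : Dec P) (q : Dec Q) → (P → Q) → (Q → P) → 𝟙 p ≡ 𝟙 q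
  𝟙-cong (yes _) (yes _) _   _   = refl
  𝟙-cong (yes p) (no ¬q) P→Q _   = ⊥-elim (¬q (P→Q p))
  𝟙-cong (no ¬p) (yes q) _   Q→P = ⊥-elim (¬p (Q→P q))
  𝟙-cong (no _)  (no _)  _   _   = refl

  𝟙-× : (p : Dec P) (q : Dec Q) → 𝟙 (p ×-dec q) ≡ 𝟙 p * 𝟙 q
  𝟙-× (yes _) (yes _) = refl
  𝟙-× (yes _) (no _)  = refl
  𝟙-× (no _)  (yes _) = refl
  𝟙-× (no _)  (no _)  = refl

module _ {P : Set} where

  𝟙-yes : (p : Dec P) → P → 𝟙 p ≡ 1
  𝟙-yes (yes _) _ = refl
  𝟙-yes (no ¬p) p = ⊥-elim (¬p p)

  𝟙-no : (p : Dec P) → ¬ P → 𝟙 p ≡ 0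
  𝟙-no (yes p) ¬p = ⊥-elim (¬p p)
  𝟙-no (no _)  _  = refl

count≡∑𝟙 : ∀ {A : Set} {P : A → Set} (P? : Decidable P) xs → count P? xs ≡ ∑ xs (𝟙 ∘ P?)
count≡∑𝟙 P? []       = refl
count≡∑𝟙 P? (x ∷ xs) with P? x
... | yes _ = cong suc (count≡∑𝟙 P? xs)
... | no _  = count≡∑𝟙 P? xs

Enumerates : {A : Set} → List A → Set
Enumerates {A} xs = Unique xs × (∀ x → x ∈ xs)

allVecOf : ∀ {A : Set} → List A → (n : ℕ) → List (Vec A n)
allVecOf xs zero    = [] ∷ []
allVecOf xs (suc n) = concatMap (λ x → map (x ∷_) (allVecOf xs n)) xs

allVec≡allVecOf : ∀ k n → allVec k n ≡ allVecOf (allFin k) n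
allVec≡allVecOf k zero    = refl
allVec≡allVecOf k (suc n) = cong (λ vs → concatMap (λ x → map (x ∷_) vs) (allFin k)) (allVec≡allVecOf k n)

allVecOf-enumerates : ∀ {A : Set} {xs : List A} → Enumerates xs → ∀ n → Enumerates (allVecOf xs n)
allVecOf-enumerates xs-enum zero = [] ∷ [] , λ { [] → here refl }
allVecOf-enumerates {A} {xs} xs-enum@(xs! , ∈xs) (suc n) with allVecOf-enumerates xs-enum n
... | vs! , ∈vs =
  Uniqueₚ.concat⁺ (Allₚ.map⁺ (All.tabulate λ _ → Uniqueₚ.map⁺ Vecₚ.∷-injectiveʳ vs!))
                   (AllPairsₚ.map⁺ (AllPairs.map disjoint xs!)) ,
  λ { (x ∷ v) → ∈-concatMap⁺ (λ y → map (y ∷_) (allVecOf xs n)) (Any.map (λ { refl → ∈-map⁺ (x ∷_) (∈vs v) }) (∈xs x)) }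
  where
  disjoint : ∀ {x y} → x ≢ y → Disjoint (map (x ∷_) (allVecOf xs n)) (map (y ∷_) (allVecOf xs n))
  disjoint x≢y (v∈x , v∈y) with ∈-map⁻ _ v∈x | ∈-map⁻ _ v∈y
  ... | _ , _ , refl | _ , _ , eq = x≢y (Vecₚ.∷-injectiveˡ eq)

allVec-enumerates : ∀ k n → Enumerates (allVec k n)
allVec-enumerates k n =
  subst Enumerates (sym (allVec≡allVecOf k n)) (allVecOf-enumerates (Uniqueₚ.allFin⁺ k , ∈-allFin) n)

cartesianProduct-enumerates : ∀ {A B : Set} {xs : List A} {ys : List B} →
  Enumerates xs → Enumerates ys → Enumerates (cartesianProduct xs ys)
cartesianProduct-enumerates (xs! , ∈xs) (ys! , ∈ys) =
  Uniqueₚ.cartesianProduct⁺ xs! ys! , λ (x , y) → ∈-cartesianProduct⁺ (∈xs x) (∈ys y)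

module _ {A : Set} where

  count-CountIs : ∀ {P : A → Set} (P? : Decidable P) {xs} → Enumerates xs → CountIs P (count P? xs)
  count-CountIs P? {xs} (xs! , ∈xs) =
    filter P? xs , Uniqueₚ.filter⁺ P? xs! ,
    (λ x → mk⇔ (proj₂ ∘ ∈-filter⁻ P? {xs = xs}) (∈-filter⁺ P? (∈xs x))) , refl

  CountIs-functional : ∀ {P : A → Set} {m m′} → CountIs P m → CountIs P m′ → m ≡ m′
  CountIs-functional (l , l! , ∈l , refl) (l′ , l′! , ∈l′ , refl) =
    ↭-length (∼bag⇒↭ (unique∧set⇒bag l! l′! (λ {x} →
      mk⇔ (Equivalence.from (∈l′ x) ∘ Equivalence.to (∈l x)) (Equivalence.from (∈l x) ∘ Equivalence.to (∈l′ x)))))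

module _ {A B : Set} {P : A → Set} {Q : B → Set} (f : A → B) (g : B → A)
         (f-resp : ∀ a → P a → Q (f a)) (g-resp : ∀ b → Q b → P (g b))
         (g∘f : ∀ a → P a → g (f a) ≡ a) (f∘g : ∀ b → Q b → f (g b) ≡ b) where

  CountIs-bijection : ∀ {m} → CountIs P m → CountIs Q m
  CountIs-bijection (l , l! , ∈l , refl) =
    map f l , map-unique l l! (All.tabulate (Equivalence.to (∈l _))) , ∈map , Listₚ.length-map f l
    where
    map-unique : ∀ l → Unique l → All P l → Unique (map f l)
    map-unique []      []          []          = []
    map-unique (x ∷ l) (x∉ ∷ l!) (px ∷ pl) =
      Allₚ.map⁺ (All.zipWith (λ (x≢y , py) fx≡fy → x≢y (trans (sym (g∘f x px)) (trans (cong g fx≡fy) (g∘f _ py))))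
                             (x∉ , pl))
      ∷ map-unique l l! pl
    ∈map : ∀ b → b ∈ map f l ⇔ Q b
    ∈map b = mk⇔
      (λ b∈ → let (a , a∈ , b≡) = ∈-map⁻ f b∈ in subst Q (sym b≡) (f-resp a (Equivalence.to (∈l a) a∈)))
      (λ qb → subst (_∈ map f l) (f∘g b qb) (∈-map⁺ f (Equivalence.from (∈l (g b)) (g-resp b qb))))

  count-bijection : ∀ (P? : Decidable P) (Q? : Decidable Q) {xs ys} → Enumerates xs → Enumerates ys →
    count P? xs ≡ count Q? ys
  count-bijection P? Q? xs-enum ys-enum =
    CountIs-functional (CountIs-bijection (count-CountIs P? xs-enum)) (count-CountIs Q? ys-enum)

-- Contracting edges

module Merge {m : ℕ} {p q : Fin (suc m)} (p≢q : p ≢ q) where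

  merge : Fin (suc m) → Fin m
  merge x with x Fin.≟ q
  ... | yes _  = punchOut (p≢q ∘ sym)
  ... | no x≢q = punchOut (x≢q ∘ sym)

  merge-identifies : merge p ≡ merge q
  merge-identifies with p Fin.≟ q | q Fin.≟ q
  ... | yes p≡q | _       = ⊥-elim (p≢q p≡q)
  ... | no _    | yes _   = Finₚ.punchOut-cong q refl
  ... | no _    | no q≢q  = ⊥-elim (q≢q refl)

  merge-fibres : ∀ x y → merge x ≡ merge y → x ≡ y ⊎ (x ≡ p × y ≡ q) ⊎ (x ≡ q × y ≡ p)
  merge-fibres x y eq with x Fin.≟ q | y Fin.≟ q
  ... | yes refl | yes refl = inj₁ refl
  ... | yes refl | no y≢q   = inj₂ (inj₂ (refl , sym (Finₚ.punchOut-injective (p≢q ∘ sym) (y≢q ∘ sym) eq)))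
  ... | no x≢q   | yes refl = inj₂ (inj₁ (Finₚ.punchOut-injective (x≢q ∘ sym) (p≢q ∘ sym) eq , refl))
  ... | no x≢q   | no y≢q   = inj₁ (Finₚ.punchOut-injective (x≢q ∘ sym) (y≢q ∘ sym) eq)

  merge-punchIn : ∀ j → merge (punchIn q j) ≡ j
  merge-punchIn j with punchIn q j Fin.≟ q
  ... | yes eq = ⊥-elim (Finₚ.punchInᵢ≢i q j eq)
  ... | no _   = trans (Finₚ.punchOut-cong q refl) (Finₚ.punchOut-punchIn q)

module _ {n : ℕ} where

  Link : List (Fin n × Fin n) → Fin n → Fin n → Set
  Link C u v = (u , v) ∈ C ⊎ (v , u) ∈ C

  Connected : List (Fin n × Fin n) → Fin n → Fin n → Set
  Connected C = Star (Link C)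

  Link-sym : ∀ {C u v} → Link C u v → Link C v u
  Link-sym (inj₁ uv∈C) = inj₂ uv∈C
  Link-sym (inj₂ vu∈C) = inj₁ vu∈C

  Connected-sym : ∀ {C u v} → Connected C u v → Connected C v u
  Connected-sym ε         = ε
  Connected-sym (l ◅ lks) = Connected-sym lks ◅◅ (Link-sym l ◅ ε)

  Link-weaken : ∀ {e C u v} → Link C u v → Link (e ∷ C) u v
  Link-weaken (inj₁ uv∈C) = inj₁ (there uv∈C)
  Link-weaken (inj₂ vu∈C) = inj₂ (there vu∈C)

  Connected-weaken : ∀ {e C u v} → Connected C u v → Connected (e ∷ C) u v
  Connected-weaken = gmap id Link-weaken

record QuotientMap (n m : ℕ) : Set where
  field
    class     : Fin n → Fin m
    rep       : Fin m → Fin n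
    class-rep : ∀ j → class (rep j) ≡ j
open QuotientMap public

module _ {n : ℕ} where

  identityQuotient : QuotientMap n n
  identityQuotient = record { class = id ; rep = id ; class-rep = λ _ → refl }

  merged : ∀ {m} (Q : QuotientMap n (suc m)) {p q} → p ≢ q → QuotientMap n m
  merged Q {q = q} p≢q = record
    { class     = merge ∘ class Q
    ; rep       = rep Q ∘ punchIn q
    ; class-rep = λ j → trans (cong merge (class-rep Q (punchIn q j))) (merge-punchIn j) }
    where open Merge p≢q

  size≤ : ∀ {m} → QuotientMap n m → m ≤ n
  size≤ Q = Finₚ.injective⇒≤ (λ {i} {j} eq → trans (sym (class-rep Q i)) (trans (cong (class Q) eq) (class-rep Q j)))

  identifyBy : ∀ {m} (Q : QuotientMap n m) (p q : Fin m) → Dec (p ≡ q) → Σ ℕ (QuotientMap n)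
  identifyBy {m}     Q p  q (yes _)  = m , Q
  identifyBy {suc m} Q p  q (no p≢q) = m , merged Q p≢q
  identifyBy {zero}  Q () q (no _)

  identifyPoints : Σ ℕ (QuotientMap n) → Fin n → Fin n → Σ ℕ (QuotientMap n)
  identifyPoints (_ , Q) a b = identifyBy Q (class Q a) (class Q b) (class Q a Fin.≟ class Q b)

  quotient : List (Fin n × Fin n) → Σ ℕ (QuotientMap n)
  quotient []            = n , identityQuotient
  quotient ((a , b) ∷ C) = identifyPoints (quotient C) a b

  size : List (Fin n × Fin n) → ℕ
  size C = proj₁ (quotient C)

  classOf : (C : List (Fin n × Fin n)) → Fin n → Fin (size C)
  classOf C = class (proj₂ (quotient C))

  repOf : (C : List (Fin n × Fin n)) → Fin (size C) → Fin n
  repOf C = rep (proj₂ (quotient C))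

  classOf-repOf : ∀ C j → classOf C (repOf C j) ≡ j
  classOf-repOf C = class-rep (proj₂ (quotient C))

  size≤n : ∀ C → size C ≤ n
  size≤n C = size≤ (proj₂ (quotient C))

  identify : ∀ {m} (Q : QuotientMap n m) (a b : Fin n) (d : Dec (class Q a ≡ class Q b)) →
             QuotientMap n (proj₁ (identifyBy Q (class Q a) (class Q b) d))
  identify Q a b d = proj₂ (identifyBy Q (class Q a) (class Q b) d)

  identify-resp : ∀ {m} (Q : QuotientMap n m) a b d {x y} →
    class Q x ≡ class Q y → class (identify Q a b d) x ≡ class (identify Q a b d) y
  identify-resp         Q a b (yes _)  eq = eq
  identify-resp {suc m} Q a b (no p≢q) eq = cong (Merge.merge p≢q) eq
  identify-resp {zero}  Q a b (no _)   eq = ⊥-elim (Finₚ.¬Fin0 (class Q a))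

  identify-identifies : ∀ {m} (Q : QuotientMap n m) a b d → class (identify Q a b d) a ≡ class (identify Q a b d) b
  identify-identifies         Q a b (yes eq)  = eq
  identify-identifies {suc m} Q a b (no p≢q) = Merge.merge-identifies p≢q
  identify-identifies {zero}  Q a b (no _)   = ⊥-elim (Finₚ.¬Fin0 (class Q a))

  identify-fibres : ∀ {m} (Q : QuotientMap n m) a b d x y → class (identify Q a b d) x ≡ class (identify Q a b d) y →
    class Q x ≡ class Q y ⊎ (class Q x ≡ class Q a × class Q y ≡ class Q b)
                          ⊎ (class Q x ≡ class Q b × class Q y ≡ class Q a)
  identify-fibres         Q a b (yes _)  x y eq = inj₁ eq
  identify-fibres {suc m} Q a b (no p≢q) x y eq = Merge.merge-fibres p≢q (class Q x) (class Q y) eq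
  identify-fibres {zero}  Q a b (no _)   x y eq = ⊥-elim (Finₚ.¬Fin0 (class Q a))

  identify-size : ∀ {m} (Q : QuotientMap n m) a b d → class Q a ≢ class Q b →
    suc (proj₁ (identifyBy Q (class Q a) (class Q b) d)) ≡ m
  identify-size         Q a b (yes eq) ne = ⊥-elim (ne eq)
  identify-size {suc m} Q a b (no _)   _  = refl
  identify-size {zero}  Q a b (no _)   _  = ⊥-elim (Finₚ.¬Fin0 (class Q a))

  private
    sameClass? : ∀ C (a b : Fin n) → Dec (classOf C a ≡ classOf C b)
    sameClass? C a b = classOf C a Fin.≟ classOf C b

  size-contract : ∀ C a b → classOf C a ≢ classOf C b → suc (size ((a , b) ∷ C)) ≡ size C
  size-contract C a b = identify-size (proj₂ (quotient C)) a b (sameClass? C a b)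

  classOf-link : ∀ C {u v} → (u , v) ∈ C → classOf C u ≡ classOf C v
  classOf-link ((a , b) ∷ C) (here refl) = identify-identifies (proj₂ (quotient C)) a b (sameClass? C a b)
  classOf-link ((a , b) ∷ C) (there uv∈C) = identify-resp (proj₂ (quotient C)) a b (sameClass? C a b) (classOf-link C uv∈C)

  Connected⇒classOf≡ : ∀ C {u v} → Connected C u v → classOf C u ≡ classOf C v
  Connected⇒classOf≡ C ε                 = refl
  Connected⇒classOf≡ C (inj₁ uv∈C ◅ lks) = trans (classOf-link C uv∈C) (Connected⇒classOf≡ C lks)
  Connected⇒classOf≡ C (inj₂ vu∈C ◅ lks) = trans (sym (classOf-link C vu∈C)) (Connected⇒classOf≡ C lks)

  classOf≡⇒Connected : ∀ C {u v} → classOf C u ≡ classOf C v → Connected C u v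
  classOf≡⇒Connected []            refl = ε
  classOf≡⇒Connected ((a , b) ∷ C) {u} {v} eq with identify-fibres (proj₂ (quotient C)) a b (sameClass? C a b) u v eq
  ... | inj₁ u~v                = Connected-weaken (classOf≡⇒Connected C u~v)
  ... | inj₂ (inj₁ (u~a , v~b)) = Connected-weaken (classOf≡⇒Connected C u~a)
                                  ◅◅ (inj₁ (here refl) ◅ Connected-weaken (classOf≡⇒Connected C (sym v~b)))
  ... | inj₂ (inj₂ (u~b , v~a)) = Connected-weaken (classOf≡⇒Connected C u~b)
                                  ◅◅ (inj₂ (here refl) ◅ Connected-weaken (classOf≡⇒Connected C (sym v~a)))

-- Paths

module _ {A : Set} {T R S : A → A → Set} (split : ∀ {u v} → T u v → R u v ⊎ S u v) where

  Star-firstStep : ∀ {x y} → Star T x y → Star R x y ⊎ ∃₂ λ u v → Star R x u × S u v × Star T v y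
  Star-firstStep ε = inj₁ ε
  Star-firstStep (t ◅ ts) with split t | Star-firstStep ts
  ... | inj₂ s | _                          = inj₂ (_ , _ , ε , s , ts)
  ... | inj₁ r | inj₁ rs                    = inj₁ (r ◅ rs)
  ... | inj₁ r | inj₂ (u , v , rs , s , ts′) = inj₂ (u , v , r ◅ rs , s , ts′)

  Star-lastStep : ∀ {x y} → Star T x y → Star R x y ⊎ ∃₂ λ u v → Star T x u × S u v × Star R v y
  Star-lastStep ε = inj₁ ε
  Star-lastStep (t ◅ ts) with split t | Star-lastStep ts
  ... | _      | inj₂ (u , v , ts′ , s , rs) = inj₂ (u , v , t ◅ ts′ , s , rs)
  ... | inj₁ r | inj₁ rs                    = inj₁ (r ◅ rs)
  ... | inj₂ s | inj₁ rs                    = inj₂ (_ , _ , ε , s , rs)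

  Star-outerSteps : ∀ {x y} → Star T x y →
    Star R x y ⊎ ∃₂ λ u v → ∃₂ λ u′ v′ → Star R x u × S u v × S u′ v′ × Star R v′ y
  Star-outerSteps ts with Star-firstStep ts
  ... | inj₁ rs = inj₁ rs
  ... | inj₂ (u , v , rs , s , ts′) with Star-lastStep ts′
  ...   | inj₁ rs′                         = inj₂ (u , v , u , v , rs , s , s , rs′)
  ...   | inj₂ (u′ , v′ , _ , s′ , rs′) = inj₂ (u , v , u′ , v′ , rs , s , s′ , rs′)

module Reachability {A : Set} (_≟_ : DecidableEquality A) (univ : List A) (∈univ : ∀ x → x ∈ univ)
                    {R : A → A → Set} (R? : ∀ x y → Dec (R x y)) where

  data Through (V : List A) : A → A → Set where
    direct  : ∀ {u v} → R u v → Through V u v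
    _∷_via_ : ∀ {u x v} → R u x → Through V x v → x ∈ V → Through V u v

  private
    widen : ∀ {V} x {u v} → Through V u v → Through (x ∷ V) u v
    widen x (direct r)      = direct r
    widen x (r ∷ p via y∈V) = r ∷ widen x p via there y∈V

    glue : ∀ {V x u v} → Through V u x → Through V x v → Through (x ∷ V) u v
    glue {x = x} (direct r) q = r ∷ widen x q via here refl
    glue (r ∷ p via y∈V) q    = r ∷ glue p q via there y∈V

    unglue : ∀ {V x u v} → Through (x ∷ V) u v → Through V u v ⊎ (Through V u x × Through V x v)
    unglue (direct r) = inj₁ (direct r)
    unglue (r ∷ p via here refl) with unglue p
    ... | inj₁ q       = inj₂ (direct r , q)
    ... | inj₂ (_ , q) = inj₂ (direct r , q)
    unglue (r ∷ p via there y∈V) with unglue p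
    ... | inj₁ q        = inj₁ (r ∷ q via y∈V)
    ... | inj₂ (q , q′) = inj₂ ((r ∷ q via y∈V) , q′)

  -- Floyd–Warshall: allow the vertices of V as interior vertices one at a time.
  through? : ∀ V u v → Dec (Through V u v)
  through? [] u v with R? u v
  ... | yes r = yes (direct r)
  ... | no ¬r = no λ { (direct r) → ¬r r ; (_ ∷ _ via ()) }
  through? (x ∷ V) u v with through? V u v | through? V u x | through? V x v
  ... | yes p | _      | _      = yes (widen x p)
  ... | no ¬p | yes p  | yes q  = yes (glue p q)
  ... | no ¬p | yes _  | no ¬q  = no λ pq → [ ¬p , (λ (_ , q) → ¬q q) ] (unglue pq)
  ... | no ¬p | no ¬p′ | _      = no λ pq → [ ¬p , (λ (p , _) → ¬p′ p) ] (unglue pq)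

  private
    Through⇒Star : ∀ {V u v} → Through V u v → Star R u v
    Through⇒Star (direct r)    = r ◅ ε
    Through⇒Star (r ∷ p via _) = r ◅ Through⇒Star p

    Star⇒Through : ∀ {u v} → Star R u v → u ≡ v ⊎ Through univ u v
    Star⇒Through ε = inj₁ refl
    Star⇒Through (_◅_ {j = x} r rs) with Star⇒Through rs
    ... | inj₁ refl = inj₂ (direct r)
    ... | inj₂ p    = inj₂ (r ∷ p via ∈univ x)

  star? : ∀ u v → Dec (Star R u v)
  star? u v with u ≟ v | through? univ u v
  ... | yes refl | _      = yes ε
  ... | no _     | yes p  = yes (Through⇒Star p)
  ... | no u≢v   | no ¬p  = no λ rs → [ u≢v , ¬p ] (Star⇒Through rs)

-- Orientations of a graph with some edges contracted

module _ {n : ℕ} where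

  graphOf : List (Fin n × Fin n) → Graph n
  graphOf E = record { edges = E }

  tailOf headOf : (E : List (Fin n × Fin n)) → Orientation (graphOf E) → Fin (length E) → Fin n
  tailOf E γ i = proj₁ (arc (graphOf E) γ i)
  headOf E γ i = proj₂ (arc (graphOf E) γ i)

  data Step (E C : List (Fin n × Fin n)) (γ : Orientation (graphOf E)) : Fin n → Fin n → Set where
    arcStep  : ∀ i → Step E C γ (tailOf E γ i) (headOf E γ i)
    linkStep : ∀ {u v} → Link C u v → Step E C γ u v

  Reach : (E C : List (Fin n × Fin n)) → Orientation (graphOf E) → Fin n → Fin n → Set
  Reach E C γ = Star (Step E C γ)

  HasCycle : (E C : List (Fin n × Fin n)) → Orientation (graphOf E) → Set
  HasCycle E C γ = ∃ λ i → Reach E C γ (headOf E γ i) (tailOf E γ i)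

  Connected⇒Reach : ∀ {E C γ x y} → Connected C x y → Reach E C γ x y
  Connected⇒Reach = gmap id linkStep

  Reach-addArc : ∀ {e d E C γ x y} → Reach E C γ x y → Reach (e ∷ E) C (d ∷ γ) x y
  Reach-addArc = gmap id (λ { (arcStep i) → arcStep (Fin.suc i) ; (linkStep l) → linkStep l })

  Reach-addLink : ∀ {e E C γ x y} → Reach E C γ x y → Reach E (e ∷ C) γ x y
  Reach-addLink = gmap id (λ { (arcStep i) → arcStep i ; (linkStep l) → linkStep (Link-weaken l) })

  Step⇒Arc⊎Link : ∀ {E C γ u v} → Step E C γ u v → Arc (graphOf E) γ u v ⊎ Link C u v
  Step⇒Arc⊎Link (arcStep i)  = inj₁ (i , refl)
  Step⇒Arc⊎Link (linkStep l) = inj₂ l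

  Reach⇒Connected⊎arc : ∀ {E C γ x y} → Reach E C γ x y →
    Connected C x y ⊎ ∃ λ i → Reach E C γ x (tailOf E γ i) × Reach E C γ (headOf E γ i) y
  Reach⇒Connected⊎arc {E} {C} {γ} rs with Star-firstStep {S = Arc (graphOf E) γ} (swap ∘ Step⇒Arc⊎Link) rs
  ... | inj₁ lks = inj₁ lks
  ... | inj₂ (_ , _ , lks , (i , refl) , rs′) = inj₂ (i , Connected⇒Reach lks , rs′)

  private
    Link-singleton : ∀ {e : Fin n × Fin n} {C x y} → Link (e ∷ []) x y → Link (e ∷ C) x y
    Link-singleton (inj₁ (here p)) = inj₁ (here p)
    Link-singleton (inj₂ (here p)) = inj₂ (here p)

    splitArc : ∀ {e d E C γ x y} → Step (e ∷ E) C (d ∷ γ) x y → Step E C γ x y ⊎ orient e d ≡ (x , y)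
    splitArc (arcStep Fin.zero)    = inj₂ refl
    splitArc (arcStep (Fin.suc i)) = inj₁ (arcStep i)
    splitArc (linkStep l)          = inj₁ (linkStep l)

    splitLink : ∀ {e E C γ x y} → Step E (e ∷ C) γ x y → Step E C γ x y ⊎ Link (e ∷ []) x y
    splitLink (arcStep i)                  = inj₁ (arcStep i)
    splitLink (linkStep (inj₁ (here p)))   = inj₂ (inj₁ (here p))
    splitLink (linkStep (inj₁ (there m)))  = inj₁ (linkStep (inj₁ m))
    splitLink (linkStep (inj₂ (here p)))   = inj₂ (inj₂ (here p))
    splitLink (linkStep (inj₂ (there m)))  = inj₁ (linkStep (inj₂ m))

  HasCycle-addArc : ∀ {e d E C γ} →
    HasCycle (e ∷ E) C (d ∷ γ) ⇔ (HasCycle E C γ ⊎ Reach E C γ (proj₂ (orient e d)) (proj₁ (orient e d)))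
  HasCycle-addArc {e} {d} {E} {C} {γ} = mk⇔ to from
    where
    to : HasCycle (e ∷ E) C (d ∷ γ) → HasCycle E C γ ⊎ Reach E C γ (proj₂ (orient e d)) (proj₁ (orient e d))
    to (Fin.zero , rs) with Star-outerSteps {R = Step E C γ} {S = λ x y → orient e d ≡ (x , y)} splitArc rs
    ... | inj₁ rs′                                   = inj₂ rs′
    ... | inj₂ (_ , _ , _ , _ , rs′ , refl , _ , _) = inj₂ rs′
    to (Fin.suc j , rs) with Star-outerSteps {R = Step E C γ} {S = λ x y → orient e d ≡ (x , y)} splitArc rs
    ... | inj₁ rs′                                         = inj₁ (j , rs′)
    ... | inj₂ (_ , _ , _ , _ , rs′ , refl , refl , rs″) = inj₂ (rs″ ◅◅ (arcStep j ◅ rs′))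
    from : HasCycle E C γ ⊎ Reach E C γ (proj₂ (orient e d)) (proj₁ (orient e d)) → HasCycle (e ∷ E) C (d ∷ γ)
    from (inj₁ (i , rs)) = Fin.suc i , Reach-addArc rs
    from (inj₂ rs)       = Fin.zero , Reach-addArc rs

  HasCycle-addLink : ∀ {e E C γ} → HasCycle E C γ → HasCycle E (e ∷ C) γ
  HasCycle-addLink (i , rs) = i , Reach-addLink rs

  HasCycle-closeLink : ∀ {e E C γ x y} → Link (e ∷ []) y x → ¬ Connected C x y → Reach E C γ x y → HasCycle E (e ∷ C) γ
  HasCycle-closeLink link ¬x~y rs with Reach⇒Connected⊎arc rs
  ... | inj₁ x~y = ⊥-elim (¬x~y x~y)
  ... | inj₂ (i , rs₁ , rs₂) = i , Reach-addLink rs₂ ◅◅ (linkStep (Link-singleton link) ◅ Reach-addLink rs₁)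

  HasCycle-twoWay : ∀ {E C γ a b} → ¬ Connected C a b → Reach E C γ a b → Reach E C γ b a → HasCycle E C γ
  HasCycle-twoWay ¬a~b rs₁ rs₂ with Reach⇒Connected⊎arc rs₂
  ... | inj₁ b~a = ⊥-elim (¬a~b (Connected-sym b~a))
  ... | inj₂ (i , rs₃ , rs₄) = i , rs₄ ◅◅ (rs₁ ◅◅ rs₃)

  HasCycle-contract : ∀ {E C γ a b} → ¬ Connected C a b →
    HasCycle E ((a , b) ∷ C) γ ⇔ (HasCycle E C γ ⊎ Reach E C γ b a ⊎ Reach E C γ a b)
  HasCycle-contract {E} {C} {γ} {a} {b} ¬a~b = mk⇔ to from
    where
    from : HasCycle E C γ ⊎ Reach E C γ b a ⊎ Reach E C γ a b → HasCycle E ((a , b) ∷ C) γ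
    from (inj₁ cyc)        = HasCycle-addLink cyc
    from (inj₂ (inj₁ rba)) = HasCycle-closeLink (inj₁ (here refl)) (¬a~b ∘ Connected-sym) rba
    from (inj₂ (inj₂ rab)) = HasCycle-closeLink (inj₂ (here refl)) ¬a~b rab
    to : HasCycle E ((a , b) ∷ C) γ → HasCycle E C γ ⊎ Reach E C γ b a ⊎ Reach E C γ a b
    to (i , rs) with Star-outerSteps {R = Step E C γ} {S = Link ((a , b) ∷ [])} splitLink rs
    ... | inj₁ rs′ = inj₁ (i , rs′)
    ... | inj₂ (_ , _ , _ , _ , rs₁ , s₁ , s₂ , rs₂) = close s₁ s₂ rs₁ rs₂
      where
      close : ∀ {u v u′ v′} → Link ((a , b) ∷ []) u v → Link ((a , b) ∷ []) u′ v′ →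
        Reach E C γ (headOf E γ i) u → Reach E C γ v′ (tailOf E γ i) →
        HasCycle E C γ ⊎ Reach E C γ b a ⊎ Reach E C γ a b
      close (inj₁ (here refl)) (inj₁ (here refl)) rs₁ rs₂ = inj₂ (inj₁ (rs₂ ◅◅ (arcStep i ◅ rs₁)))
      close (inj₁ (here refl)) (inj₂ (here refl)) rs₁ rs₂ = inj₁ (i , rs₁ ◅◅ rs₂)
      close (inj₂ (here refl)) (inj₁ (here refl)) rs₁ rs₂ = inj₁ (i , rs₁ ◅◅ rs₂)
      close (inj₂ (here refl)) (inj₂ (here refl)) rs₁ rs₂ = inj₂ (inj₂ (rs₂ ◅◅ (arcStep i ◅ rs₁)))

  private
    pair? : (p q : Fin n × Fin n) → Dec (p ≡ q)
    pair? = Productₚ.≡-dec Fin._≟_ Fin._≟_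
    open DecMembership pair? using (_∈?_)

    step? : ∀ E C γ u v → Dec (Step E C γ u v)
    step? E C γ u v =
      map′ [ (λ { (i , refl) → arcStep i }) , linkStep ] Step⇒Arc⊎Link
        (Finₚ.any? (λ i → pair? (arc (graphOf E) γ i) (u , v)) ⊎-dec (((u , v) ∈? C) ⊎-dec ((v , u) ∈? C)))

  reach? : ∀ E C γ u v → Dec (Reach E C γ u v)
  reach? E C γ = Reachability.star? Fin._≟_ (allFin n) ∈-allFin (step? E C γ)

  hasCycle? : ∀ E C γ → Dec (HasCycle E C γ)
  hasCycle? E C γ = Finₚ.any? (λ i → reach? E C γ _ _)

𝟙-inclusion-exclusion : ∀ {A P Q : Set} (a : Dec A) (p : Dec P) (q : Dec Q) → (A → P → Q → ⊥) →
  𝟙 (a ×-dec ¬? p) + 𝟙 (a ×-dec ¬? q) ≡ 𝟙 a + 𝟙 (a ×-dec (¬? p ×-dec ¬? q))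
𝟙-inclusion-exclusion (no _)  _       _       _ = refl
𝟙-inclusion-exclusion (yes A) (yes P) (yes Q) excl = ⊥-elim (excl A P Q)
𝟙-inclusion-exclusion (yes _) (yes _) (no _)  _ = refl
𝟙-inclusion-exclusion (yes _) (no _)  (yes _) _ = refl
𝟙-inclusion-exclusion (yes _) (no _)  (no _)  _ = refl

orientations : (m : ℕ) → List (Vec Bool m)
orientations = allVecOf (true ∷ false ∷ [])

orientations-enumerates : ∀ m → Enumerates (orientations m)
orientations-enumerates = allVecOf-enumerates (((λ ()) ∷ []) ∷ [] ∷ [] , λ { true → here refl ; false → there (here refl) })

∑-orientations : ∀ m (f : Vec Bool (suc m) → ℕ) →
  ∑ (orientations (suc m)) f ≡ ∑ (orientations m) (f ∘ (true ∷_)) + ∑ (orientations m) (f ∘ (false ∷_))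
∑-orientations m f =
  trans (∑-concatMap (λ d → map (d ∷_) (orientations m)) (true ∷ false ∷ []) f)
        (cong₂ _+_ (∑-map (true ∷_) (orientations m) f)
                   (trans (ℕₚ.+-identityʳ _) (∑-map (false ∷_) (orientations m) f)))

module _ {n k : ℕ} where

  rank : Vec (Fin k) n → Fin n → ℕ
  rank κ v = toℕ (lookup κ v)

  ConstantOn : List (Fin n × Fin n) → Vec (Fin k) n → Set
  ConstantOn C κ = All (λ e → lookup κ (proj₁ e) ≡ lookup κ (proj₂ e)) C

  constantOn? : ∀ C κ → Dec (ConstantOn C κ)
  constantOn? C κ = All.all? (λ e → lookup κ (proj₁ e) Fin.≟ lookup κ (proj₂ e)) C

  ConstantOn-Connected : ∀ {C} κ {u v} → ConstantOn C κ → Connected C u v → lookup κ u ≡ lookup κ v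
  ConstantOn-Connected κ κ-const ε              = refl
  ConstantOn-Connected κ κ-const (inj₁ m ◅ lks) = trans (All.lookup κ-const m) (ConstantOn-Connected κ κ-const lks)
  ConstantOn-Connected κ κ-const (inj₂ m ◅ lks) = trans (sym (All.lookup κ-const m)) (ConstantOn-Connected κ κ-const lks)

  weaklyProper? : ∀ E γ κ → Dec (WeaklyProper (graphOf E) γ κ)
  weaklyProper? E γ κ = Finₚ.all? (λ i → rank κ (tailOf E γ i) ℕ.≤? rank κ (headOf E γ i))

  WeaklyProper-addArc : ∀ {e d E γ κ} → WeaklyProper (graphOf (e ∷ E)) (d ∷ γ) κ ⇔
    (rank κ (proj₁ (orient e d)) ≤ rank κ (proj₂ (orient e d)) × WeaklyProper (graphOf E) γ κ)
  WeaklyProper-addArc = mk⇔ (λ wp → wp Fin.zero , wp ∘ Fin.suc)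
                            (λ { (≤₀ , wp) Fin.zero → ≤₀ ; (≤₀ , wp) (Fin.suc i) → wp i })

  Reach-monotone : ∀ {E C γ} κ {u v} → WeaklyProper (graphOf E) γ κ → ConstantOn C κ →
    Reach E C γ u v → rank κ u ≤ rank κ v
  Reach-monotone κ wp κ-const ε                 = ℕₚ.≤-refl
  Reach-monotone κ wp κ-const (arcStep i ◅ rs)  = ℕₚ.≤-trans (wp i) (Reach-monotone κ wp κ-const rs)
  Reach-monotone κ wp κ-const (linkStep l ◅ rs) =
    ℕₚ.≤-trans (ℕₚ.≤-reflexive (cong toℕ (ConstantOn-Connected κ κ-const (l ◅ ε)))) (Reach-monotone κ wp κ-const rs)

  AcyclicWP : ∀ E → List (Fin n × Fin n) → Orientation (graphOf E) → Vec (Fin k) n → Set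
  AcyclicWP E C γ κ = ¬ HasCycle E C γ × WeaklyProper (graphOf E) γ κ

  acyclicWP? : ∀ E C γ κ → Dec (AcyclicWP E C γ κ)
  acyclicWP? E C γ κ = ¬? (hasCycle? E C γ) ×-dec weaklyProper? E γ κ

  AcyclicWP-addArc : ∀ {e d E C γ κ} → AcyclicWP (e ∷ E) C (d ∷ γ) κ ⇔
    (AcyclicWP E C γ κ × ¬ Reach E C γ (proj₂ (orient e d)) (proj₁ (orient e d))
                       × rank κ (proj₁ (orient e d)) ≤ rank κ (proj₂ (orient e d)))
  AcyclicWP-addArc {e} {d} {E} {C} {γ} {κ} = mk⇔
    (λ (¬cyc , wp) → let (≤₀ , wp′) = WP.to wp in (¬cyc ∘ Cyc.from ∘ inj₁ , wp′) , ¬cyc ∘ Cyc.from ∘ inj₂ , ≤₀)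
    (λ ((¬cyc , wp) , ¬reach , ≤₀) → (¬cyc ¬-⊎ ¬reach) ∘ Cyc.to , WP.from (≤₀ , wp))
    where
    module Cyc = Equivalence (HasCycle-addArc {e = e} {d = d} {E = E} {C = C} {γ = γ})
    module WP = Equivalence (WeaklyProper-addArc {e = e} {d = d} {E = E} {γ = γ} {κ = κ})

  AcyclicWP-contract : ∀ {a b E C γ κ} → ¬ Connected C a b → AcyclicWP E ((a , b) ∷ C) γ κ ⇔
    (AcyclicWP E C γ κ × ¬ Reach E C γ b a × ¬ Reach E C γ a b)
  AcyclicWP-contract {a} {b} {E} {C} {γ} ¬a~b = mk⇔
    (λ (¬cyc , wp) → (¬cyc ∘ from ∘ inj₁ , wp) , ¬cyc ∘ from ∘ inj₂ ∘ inj₁ , ¬cyc ∘ from ∘ inj₂ ∘ inj₂)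
    (λ ((¬cyc , wp) , ¬ba , ¬ab) → (¬cyc ¬-⊎ ¬ba ¬-⊎ ¬ab) ∘ to , wp)
    where open Equivalence (HasCycle-contract {E = E} {C = C} {γ = γ} ¬a~b)

  acyclicCount : (E C : List (Fin n × Fin n)) → Vec (Fin k) n → ℕ
  acyclicCount E C κ = ∑ (orientations (length E)) (λ γ → 𝟙 (acyclicWP? E C γ κ))

  acyclicCount-[] : ∀ C κ → acyclicCount [] C κ ≡ 1
  acyclicCount-[] C κ = cong (_+ 0) (𝟙-yes (acyclicWP? [] C [] κ) ((λ ()) , λ ()))

  private
    acyclicCount-∷ : ∀ e E C κ → acyclicCount (e ∷ E) C κ ≡
      ∑ (orientations (length E)) (λ γ → 𝟙 (acyclicWP? (e ∷ E) C (true ∷ γ) κ) + 𝟙 (acyclicWP? (e ∷ E) C (false ∷ γ) κ))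
    acyclicCount-∷ e E C κ = trans (∑-orientations (length E) (λ γ → 𝟙 (acyclicWP? (e ∷ E) C γ κ)))
      (sym (∑-+ (orientations (length E)) (λ γ → 𝟙 (acyclicWP? (e ∷ E) C (true ∷ γ) κ))
                                          (λ γ → 𝟙 (acyclicWP? (e ∷ E) C (false ∷ γ) κ))))

    orient-level : ∀ {e : Fin n × Fin n} κ d → lookup κ (proj₁ e) ≡ lookup κ (proj₂ e) →
      rank κ (proj₁ (orient e d)) ≤ rank κ (proj₂ (orient e d))
    orient-level κ true  eq = ℕₚ.≤-reflexive (cong toℕ eq)
    orient-level κ false eq = ℕₚ.≤-reflexive (cong toℕ (sym eq))

    orient-Connected : ∀ {e : Fin n × Fin n} {E C} γ d → Connected C (proj₁ e) (proj₂ e) →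
      Reach E C γ (proj₂ (orient e d)) (proj₁ (orient e d))
    orient-Connected γ true  e~ = Connected⇒Reach (Connected-sym e~)
    orient-Connected γ false e~ = Connected⇒Reach e~

    acyclicWP-connectedArc : ∀ {e} E C κ d γ → Connected C (proj₁ e) (proj₂ e) → 𝟙 (acyclicWP? (e ∷ E) C (d ∷ γ) κ) ≡ 0
    acyclicWP-connectedArc {e} E C κ d γ e~ = 𝟙-no (acyclicWP? (e ∷ E) C (d ∷ γ) κ) λ acwp →
      proj₁ (proj₂ (Equivalence.to (AcyclicWP-addArc {e = e} {d = d} {E = E} {C = C} {γ = γ} {κ = κ}) acwp)) (orient-Connected γ d e~)

    -- Colours weakly increase along Reach, so no cycle can return from the head of an upward arc.
    acyclicWP-upwardArc : ∀ {e} E C κ d γ → ConstantOn C κ → rank κ (proj₁ (orient e d)) < rank κ (proj₂ (orient e d)) →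
      𝟙 (acyclicWP? (e ∷ E) C (d ∷ γ) κ) ≡ 𝟙 (acyclicWP? E C γ κ)
    acyclicWP-upwardArc {e} E C κ d γ κ-const t<h =
      𝟙-cong (acyclicWP? (e ∷ E) C (d ∷ γ) κ) (acyclicWP? E C γ κ) (proj₁ ∘ to) λ acwp →
        from (acwp , (λ h→t → ℕₚ.<⇒≱ t<h (Reach-monotone κ (proj₂ acwp) κ-const h→t)) , ℕₚ.<⇒≤ t<h)
      where open Equivalence (AcyclicWP-addArc {e = e} {d = d} {E = E} {C = C} {γ = γ} {κ = κ})

    acyclicWP-downwardArc : ∀ {e} E C κ d γ → rank κ (proj₂ (orient e d)) < rank κ (proj₁ (orient e d)) →
      𝟙 (acyclicWP? (e ∷ E) C (d ∷ γ) κ) ≡ 0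
    acyclicWP-downwardArc {e} E C κ d γ h<t = 𝟙-no (acyclicWP? (e ∷ E) C (d ∷ γ) κ) λ acwp →
      ℕₚ.<⇒≱ h<t (proj₂ (proj₂ (Equivalence.to (AcyclicWP-addArc {e = e} {d = d} {E = E} {C = C} {γ = γ} {κ = κ}) acwp)))

  acyclicCount-connected : ∀ {a b} E C κ → Connected C a b → acyclicCount ((a , b) ∷ E) C κ ≡ 0
  acyclicCount-connected E C κ a~b = trans (acyclicCount-∷ _ E C κ) (trans
    (∑-cong (orientations (length E)) λ γ →
      cong₂ _+_ (acyclicWP-connectedArc E C κ true γ a~b) (acyclicWP-connectedArc E C κ false γ a~b))
    (∑-zero (orientations (length E))))

  acyclicCount-distinctColours : ∀ {a b} E C κ → ConstantOn C κ → lookup κ a ≢ lookup κ b →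
    acyclicCount ((a , b) ∷ E) C κ ≡ acyclicCount E C κ
  acyclicCount-distinctColours {a} {b} E C κ κ-const κa≢κb =
    trans (acyclicCount-∷ (a , b) E C κ) (∑-cong (orientations (length E)) (byOrder (Finₚ.<-cmp (lookup κ a) (lookup κ b))))
    where
    byOrder : Tri (lookup κ a Fin.< lookup κ b) (lookup κ a ≡ lookup κ b) (lookup κ b Fin.< lookup κ a) → ∀ γ →
      𝟙 (acyclicWP? ((a , b) ∷ E) C (true ∷ γ) κ) + 𝟙 (acyclicWP? ((a , b) ∷ E) C (false ∷ γ) κ) ≡ 𝟙 (acyclicWP? E C γ κ)
    byOrder (tri< κa<κb _ _) γ = trans (cong₂ _+_ (acyclicWP-upwardArc E C κ true γ κ-const κa<κb)
                                                   (acyclicWP-downwardArc E C κ false γ κa<κb))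
                                       (ℕₚ.+-identityʳ _)
    byOrder (tri≈ _ κa≡κb _) γ = ⊥-elim (κa≢κb κa≡κb)
    byOrder (tri> _ _ κb<κa) γ = cong₂ _+_ (acyclicWP-downwardArc E C κ true γ κb<κa)
                                           (acyclicWP-upwardArc E C κ false γ κ-const κb<κa)

  -- Orienting ab as a → b (resp. b → a) creates a cycle iff b ⇝ a (resp. a ⇝ b), contracting it
  -- iff either holds, and an acyclic orientation never has both.
  acyclicCount-sameColour : ∀ {a b} E C κ → lookup κ a ≡ lookup κ b → ¬ Connected C a b →
    acyclicCount ((a , b) ∷ E) C κ ≡ acyclicCount E C κ + acyclicCount E ((a , b) ∷ C) κ
  acyclicCount-sameColour {a} {b} E C κ κa≡κb ¬a~b =
    trans (acyclicCount-∷ (a , b) E C κ) (trans (∑-cong (orientations (length E)) per-orientation)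
      (∑-+ (orientations (length E)) (λ γ → 𝟙 (acyclicWP? E C γ κ)) (λ γ → 𝟙 (acyclicWP? E ((a , b) ∷ C) γ κ))))
    where
    open ≡-Reasoning
    level : ∀ d γ → AcyclicWP ((a , b) ∷ E) C (d ∷ γ) κ ⇔
      (AcyclicWP E C γ κ × ¬ Reach E C γ (proj₂ (orient (a , b) d)) (proj₁ (orient (a , b) d)))
    level d γ = mk⇔ (λ acwp → let (acwp′ , ¬h→t , _) = to acwp in acwp′ , ¬h→t)
                    (λ (acwp′ , ¬h→t) → from (acwp′ , ¬h→t , orient-level κ d κa≡κb))
      where open Equivalence (AcyclicWP-addArc {e = a , b} {d = d} {E = E} {C = C} {γ = γ} {κ = κ})
    per-orientation : ∀ γ →
      𝟙 (acyclicWP? ((a , b) ∷ E) C (true ∷ γ) κ) + 𝟙 (acyclicWP? ((a , b) ∷ E) C (false ∷ γ) κ)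
      ≡ 𝟙 (acyclicWP? E C γ κ) + 𝟙 (acyclicWP? E ((a , b) ∷ C) γ κ)
    per-orientation γ = begin
      𝟙 (acyclicWP? ((a , b) ∷ E) C (true ∷ γ) κ) + 𝟙 (acyclicWP? ((a , b) ∷ E) C (false ∷ γ) κ)
        ≡⟨ cong₂ _+_ (𝟙-cong (acyclicWP? ((a , b) ∷ E) C (true ∷ γ) κ) (A ×-dec ¬? P?) (to (level true γ)) (from (level true γ)))
                     (𝟙-cong (acyclicWP? ((a , b) ∷ E) C (false ∷ γ) κ) (A ×-dec ¬? Q?) (to (level false γ)) (from (level false γ))) ⟩
      𝟙 (A ×-dec ¬? P?) + 𝟙 (A ×-dec ¬? Q?)
        ≡⟨ 𝟙-inclusion-exclusion A P? Q? (λ (¬cyc , _) b→a a→b → ¬cyc (HasCycle-twoWay ¬a~b a→b b→a)) ⟩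
      𝟙 A + 𝟙 (A ×-dec (¬? P? ×-dec ¬? Q?))
        ≡⟨ cong (𝟙 A +_) (𝟙-cong (A ×-dec (¬? P? ×-dec ¬? Q?)) (acyclicWP? E ((a , b) ∷ C) γ κ) (from contract) (to contract)) ⟩
      𝟙 (acyclicWP? E C γ κ) + 𝟙 (acyclicWP? E ((a , b) ∷ C) γ κ) ∎
      where
      open Equivalence using (to; from)
      A : Dec (AcyclicWP E C γ κ)
      A = acyclicWP? E C γ κ
      P? : Dec (Reach E C γ b a)
      P? = reach? E C γ b a
      Q? : Dec (Reach E C γ a b)
      Q? = reach? E C γ a b
      contract : AcyclicWP E ((a , b) ∷ C) γ κ ⇔ (AcyclicWP E C γ κ × ¬ Reach E C γ b a × ¬ Reach E C γ a b)
      contract = AcyclicWP-contract {E = E} {γ = γ} {κ = κ} ¬a~b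

-- Deletion–contraction for the two colouring counts

module Colourings {n k : ℕ} (w : Fin n → ℕ) (α : Vec ℕ k) where

  open ≡-Reasoning

  Admissible : List (Fin n × Fin n) → Vec (Fin k) n → Set
  Admissible C κ = ConstantOn C κ × HasMonomial w α κ

  admissible? : ∀ C κ → Dec (Admissible C κ)
  admissible? C κ = constantOn? C κ ×-dec hasMonomial? w α κ

  admissibleCount : List (Fin n × Fin n) → ℕ
  admissibleCount C = ∑ (allVec k n) (𝟙 ∘ admissible? C)

  properCount : (E C : List (Fin n × Fin n)) → ℕ
  properCount E C = ∑ (allVec k n) (λ κ → 𝟙 (proper? (graphOf E) κ ×-dec admissible? C κ))

  pairCount : (E C : List (Fin n × Fin n)) → ℕ
  pairCount E C = ∑ (allVec k n) (λ κ → 𝟙 (admissible? C κ) * acyclicCount E C κ)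

  properCount-[] : ∀ C → properCount [] C ≡ admissibleCount C
  properCount-[] C = ∑-cong (allVec k n) λ κ →
    𝟙-cong (proper? (graphOf []) κ ×-dec admissible? C κ) (admissible? C κ) proj₂ ([] ,_)

  pairCount-[] : ∀ C → pairCount [] C ≡ admissibleCount C
  pairCount-[] C = ∑-cong (allVec k n) λ κ →
    trans (cong (𝟙 (admissible? C κ) *_) (acyclicCount-[] C κ)) (ℕₚ.*-identityʳ (𝟙 (admissible? C κ)))

  properCount-deleteContract : ∀ a b E C → properCount E C ≡ properCount ((a , b) ∷ E) C + properCount E ((a , b) ∷ C)
  properCount-deleteContract a b E C = trans (∑-cong (allVec k n) split) (∑-+ (allVec k n) _ _)
    where
    split : ∀ κ → 𝟙 (proper? (graphOf E) κ ×-dec admissible? C κ)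
                ≡ 𝟙 (proper? (graphOf ((a , b) ∷ E)) κ ×-dec admissible? C κ)
                  + 𝟙 (proper? (graphOf E) κ ×-dec admissible? ((a , b) ∷ C) κ)
    split κ = byColours (lookup κ a Fin.≟ lookup κ b)
      where
      deleted : Dec (Proper (graphOf E) κ × Admissible C κ)
      deleted = proper? (graphOf E) κ ×-dec admissible? C κ
      kept : Dec (Proper (graphOf ((a , b) ∷ E)) κ × Admissible C κ)
      kept = proper? (graphOf ((a , b) ∷ E)) κ ×-dec admissible? C κ
      contracted : Dec (Proper (graphOf E) κ × Admissible ((a , b) ∷ C) κ)
      contracted = proper? (graphOf E) κ ×-dec admissible? ((a , b) ∷ C) κ
      byColours : Dec (lookup κ a ≡ lookup κ b) → 𝟙 deleted ≡ 𝟙 kept + 𝟙 contracted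
      byColours (yes same) = begin
        𝟙 deleted              ≡⟨ 𝟙-cong deleted contracted (λ (pr , κc , mono) → pr , (same ∷ κc) , mono)
                                                            (λ { (pr , (_ ∷ κc) , mono) → pr , κc , mono }) ⟩
        0 + 𝟙 contracted       ≡⟨ cong (_+ 𝟙 contracted) (sym (𝟙-no kept λ { ((differ ∷ _) , _) → differ same })) ⟩
        𝟙 kept + 𝟙 contracted ∎
      byColours (no differ) = begin
        𝟙 deleted              ≡⟨ 𝟙-cong deleted kept (λ (pr , adm) → (differ ∷ pr) , adm) (λ { ((_ ∷ pr) , adm) → pr , adm }) ⟩
        𝟙 kept                 ≡⟨ sym (ℕₚ.+-identityʳ (𝟙 kept)) ⟩
        𝟙 kept + 0             ≡⟨ cong (𝟙 kept +_) (sym (𝟙-no contracted λ { (_ , (same ∷ _) , _) → differ same })) ⟩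
        𝟙 kept + 𝟙 contracted ∎

  properCount-connected : ∀ {a b} E C → Connected C a b → properCount ((a , b) ∷ E) C ≡ 0
  properCount-connected {a} {b} E C a~b = trans (∑-cong (allVec k n) λ κ →
      𝟙-no (proper? (graphOf ((a , b) ∷ E)) κ ×-dec admissible? C κ)
           (λ { ((differ ∷ _) , κc , _) → differ (ConstantOn-Connected κ κc a~b) }))
    (∑-zero (allVec k n))

  pairCount-connected : ∀ {a b} E C → Connected C a b → pairCount ((a , b) ∷ E) C ≡ 0
  pairCount-connected E C a~b = trans (∑-cong (allVec k n) λ κ →
      trans (cong (𝟙 (admissible? C κ) *_) (acyclicCount-connected E C κ a~b)) (ℕₚ.*-zeroʳ (𝟙 (admissible? C κ))))
    (∑-zero (allVec k n))

  pairCount-deleteContract : ∀ a b E C → ¬ Connected C a b →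
    pairCount ((a , b) ∷ E) C ≡ pairCount E C + pairCount E ((a , b) ∷ C)
  pairCount-deleteContract a b E C ¬a~b = trans (∑-cong (allVec k n) split) (∑-+ (allVec k n) _ _)
    where
    split : ∀ κ → 𝟙 (admissible? C κ) * acyclicCount ((a , b) ∷ E) C κ
                ≡ 𝟙 (admissible? C κ) * acyclicCount E C κ + 𝟙 (admissible? ((a , b) ∷ C) κ) * acyclicCount E ((a , b) ∷ C) κ
    split κ = byAdmissibility (admissible? C κ) (lookup κ a Fin.≟ lookup κ b)
      where
      A₀ A₁ A₂ : ℕ
      A₀ = acyclicCount ((a , b) ∷ E) C κ
      A₁ = acyclicCount E C κ
      A₂ = acyclicCount E ((a , b) ∷ C) κ
      byAdmissibility : (adm? : Dec (Admissible C κ)) → Dec (lookup κ a ≡ lookup κ b) →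
        𝟙 adm? * A₀ ≡ 𝟙 adm? * A₁ + 𝟙 (admissible? ((a , b) ∷ C) κ) * A₂
      byAdmissibility (no ¬adm) _ = cong (_* A₂)
        (sym (𝟙-no (admissible? ((a , b) ∷ C) κ) λ { ((_ ∷ κc) , mono) → ¬adm (κc , mono) }))
      byAdmissibility (yes (κc , mono)) (yes same) = begin
        A₀ + 0                        ≡⟨ ℕₚ.+-identityʳ A₀ ⟩
        A₀                            ≡⟨ acyclicCount-sameColour E C κ same ¬a~b ⟩
        A₁ + A₂                       ≡⟨ cong₂ _+_ (sym (ℕₚ.*-identityˡ A₁)) (sym (ℕₚ.*-identityˡ A₂)) ⟩
        1 * A₁ + 1 * A₂               ≡⟨ cong (λ c → 1 * A₁ + c * A₂)
                                                (sym (𝟙-yes (admissible? ((a , b) ∷ C) κ) ((same ∷ κc) , mono))) ⟩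
        1 * A₁ + 𝟙 (admissible? ((a , b) ∷ C) κ) * A₂ ∎
      byAdmissibility (yes (κc , mono)) (no differ) = begin
        A₀ + 0                        ≡⟨ ℕₚ.+-identityʳ A₀ ⟩
        A₀                            ≡⟨ acyclicCount-distinctColours E C κ κc differ ⟩
        A₁                            ≡⟨ sym (trans (ℕₚ.+-identityʳ (1 * A₁)) (ℕₚ.*-identityˡ A₁)) ⟩
        1 * A₁ + 0 * A₂               ≡⟨ cong (λ c → 1 * A₁ + c * A₂)
                                                (sym (𝟙-no (admissible? ((a , b) ∷ C) κ) λ { ((same ∷ _) , _) → differ same })) ⟩
        1 * A₁ + 𝟙 (admissible? ((a , b) ∷ C) κ) * A₂ ∎

-- Colourings and acyclic orientations of G

module _ {n : ℕ} (G : Graph n) where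

  private
    Walk⁺⇒Reach : ∀ {γ u v} → Walk⁺ G γ u v → Reach (edges G) [] γ u v
    Walk⁺⇒Reach (step (i , refl)) = arcStep i ◅ ε
    Walk⁺⇒Reach ((i , refl) ∷ w)  = arcStep i ◅ Walk⁺⇒Reach w

    Reach⇒Walk⁺ : ∀ {γ u v y} → Arc G γ u v → Reach (edges G) [] γ v y → Walk⁺ G γ u y
    Reach⇒Walk⁺ a ε                         = step a
    Reach⇒Walk⁺ a (arcStep i ◅ rs)          = a ∷ Reach⇒Walk⁺ (i , refl) rs
    Reach⇒Walk⁺ a (linkStep (inj₁ ()) ◅ rs)
    Reach⇒Walk⁺ a (linkStep (inj₂ ()) ◅ rs)

    Walk⁺-first : ∀ {γ u v} → Walk⁺ G γ u v →
      ∃ λ i → tailOf (edges G) γ i ≡ u × Reach (edges G) [] γ (headOf (edges G) γ i) v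
    Walk⁺-first (step (i , refl)) = i , refl , ε
    Walk⁺-first ((i , refl) ∷ w)  = i , refl , Walk⁺⇒Reach w

  Acyclic⇔¬HasCycle : ∀ γ → Acyclic G γ ⇔ (¬ HasCycle (edges G) [] γ)
  Acyclic⇔¬HasCycle γ = mk⇔
    (λ acyclic (i , rs) → acyclic (tailOf (edges G) γ i) (Reach⇒Walk⁺ (i , refl) rs))
    (λ { ¬cycle v w → let (i , tail≡v , rs) = Walk⁺-first w in
                      ¬cycle (i , subst (Reach (edges G) [] γ _) (sym tail≡v) rs) })

  acyclic? : ∀ γ → Dec (Acyclic G γ)
  acyclic? γ = map′ from to (¬? (hasCycle? (edges G) [] γ))
    where open Equivalence (Acyclic⇔¬HasCycle γ)

  module _ {k : ℕ} (w : Fin n → ℕ) (α : Vec ℕ k) where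
    open Colourings w α

    Xcoef≡properCount : Xcoef G w α ≡ properCount (edges G) []
    Xcoef≡properCount = trans (count≡∑𝟙 _ (allVec k n)) (∑-cong (allVec k n) λ κ →
      𝟙-cong (proper? G κ ×-dec hasMonomial? w α κ) (proper? G κ ×-dec admissible? [] κ)
             (λ (pr , mono) → pr , [] , mono) (λ (pr , _ , mono) → pr , mono))

    xbarPair? : ∀ p → Dec (XbarPair G w α p)
    xbarPair? (γ , κ) = acyclic? γ ×-dec (weaklyProper? (edges G) γ κ ×-dec hasMonomial? w α κ)

    CountIs-XbarPair : ∀ {m} → CountIs (XbarPair G w α) m → m ≡ pairCount (edges G) []
    CountIs-XbarPair counted = trans
      (CountIs-functional counted (count-CountIs xbarPair?
        (cartesianProduct-enumerates (orientations-enumerates (length (edges G))) (allVec-enumerates k n))))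
      (begin
        count xbarPair? (cartesianProduct Γ (allVec k n))                ≡⟨ count≡∑𝟙 xbarPair? (cartesianProduct Γ (allVec k n)) ⟩
        ∑ (cartesianProduct Γ (allVec k n)) (𝟙 ∘ xbarPair?)              ≡⟨ ∑-cartesianProduct Γ (allVec k n) _ ⟩
        ∑ Γ (λ γ → ∑ (allVec k n) (λ κ → 𝟙 (xbarPair? (γ , κ))))         ≡⟨ ∑-comm Γ (allVec k n) _ ⟩
        ∑ (allVec k n) (λ κ → ∑ Γ (λ γ → 𝟙 (xbarPair? (γ , κ))))         ≡⟨ ∑-cong (allVec k n) per-colouring ⟩
        pairCount (edges G) [] ∎)
      where
      open ≡-Reasoning
      Γ : List (Orientation G)
      Γ = orientations (length (edges G))
      per-colouring : ∀ κ → ∑ Γ (λ γ → 𝟙 (xbarPair? (γ , κ))) ≡ 𝟙 (admissible? [] κ) * acyclicCount (edges G) [] κ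
      per-colouring κ = trans
        (∑-cong Γ λ γ → trans
          (𝟙-cong (xbarPair? (γ , κ)) (acyclicWP? (edges G) [] γ κ ×-dec admissible? [] κ)
                  (λ (ac , wp , mono) → (Equivalence.to (Acyclic⇔¬HasCycle γ) ac , wp) , [] , mono)
                  (λ ((¬cyc , wp) , _ , mono) → Equivalence.from (Acyclic⇔¬HasCycle γ) ¬cyc , wp , mono))
          (trans (𝟙-× (acyclicWP? (edges G) [] γ κ) (admissible? [] κ)) (ℕₚ.*-comm _ (𝟙 (admissible? [] κ)))))
        (∑-*ˡ Γ (𝟙 (admissible? [] κ)) _)

-- Power-sum coefficients of class weights

push : ∀ {n m} → (Fin n → Fin m) → (Fin n → ℕ) → Fin m → ℕ
push {n} r w j = ∑ (allFin n) (λ v → if ⌊ r v Fin.≟ j ⌋ then w v else 0)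

module _ {n m : ℕ} (r : Fin n → Fin m) (w : Fin n → ℕ) where

  ∑-push : ∀ (c : Fin m → Bool) →
    ∑ (allFin m) (λ j → if c j then push r w j else 0) ≡ ∑ (allFin n) (λ v → if c (r v) then w v else 0)
  ∑-push c = begin
    ∑ (allFin m) (λ j → if c j then push r w j else 0)
      ≡⟨ ∑-cong (allFin m) (λ j → if-∑ (c j) (allFin n) _) ⟩
    ∑ (allFin m) (λ j → ∑ (allFin n) (λ v → if c j then (if ⌊ r v Fin.≟ j ⌋ then w v else 0) else 0))
      ≡⟨ ∑-comm (allFin m) (allFin n) _ ⟩
    ∑ (allFin n) (λ v → ∑ (allFin m) (λ j → if c j then (if ⌊ r v Fin.≟ j ⌋ then w v else 0) else 0))
      ≡⟨ ∑-cong (allFin n) (λ v → trans (∑-cong (allFin m) (λ j → if-comm (c j) _ (w v)))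
                                          (∑-indicator (r v) (λ j → if c j then w v else 0))) ⟩
    ∑ (allFin n) (λ v → if c (r v) then w v else 0) ∎
    where
    open ≡-Reasoning
    if-∑ : ∀ {A : Set} b (xs : List A) (f : A → ℕ) → (if b then ∑ xs f else 0) ≡ ∑ xs (λ x → if b then f x else 0)
    if-∑ true  xs f = refl
    if-∑ false xs f = sym (∑-zero xs)
    if-comm : ∀ (b c : Bool) x → (if b then (if c then x else 0) else 0) ≡ (if c then (if b then x else 0) else 0)
    if-comm true  true  x = refl
    if-comm true  false x = refl
    if-comm false true  x = refl
    if-comm false false x = refl

  ∑-push-total : ∑ (allFin m) (push r w) ≡ ∑ (allFin n) w
  ∑-push-total = ∑-push (λ _ → true)

  push-∘ : ∀ {k} (c : Fin m → Fin k) i → push c (push r w) i ≡ push (c ∘ r) w i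
  push-∘ c i = ∑-push (λ j → ⌊ c j Fin.≟ i ⌋)

module Distributions {k : ℕ} (α : Vec ℕ k) where

  addAt : (Fin k → ℕ) → Fin k → ℕ → Fin k → ℕ
  addAt β c x i = β i + (if ⌊ c Fin.≟ i ⌋ then x else 0)

  -- The coefficient of x^α in x^β · p_L.
  distributions : List ℕ → (Fin k → ℕ) → ℕ
  distributions []      β = 𝟙 (Vecₚ.≡-dec ℕ._≟_ (tabulate β) α)
  distributions (x ∷ L) β = ∑ (allFin k) (λ c → distributions L (addAt β c x))

  distributions-cong : ∀ L {β β′} → (∀ i → β i ≡ β′ i) → distributions L β ≡ distributions L β′
  distributions-cong [] {β} {β′} β≗β′ =
    𝟙-cong (Vecₚ.≡-dec ℕ._≟_ (tabulate β) α) (Vecₚ.≡-dec ℕ._≟_ (tabulate β′) α)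
           (trans (Vecₚ.tabulate-cong (sym ∘ β≗β′))) (trans (Vecₚ.tabulate-cong β≗β′))
  distributions-cong (x ∷ L) β≗β′ = ∑-cong (allFin k) (λ c → distributions-cong L (λ i → cong (_+ _) (β≗β′ i)))

  distributions-↭ : ∀ {L L′} → L ↭ L′ → ∀ β → distributions L β ≡ distributions L′ β
  distributions-↭ ↭.refl          β = refl
  distributions-↭ (↭.prep x L↭L′) β = ∑-cong (allFin k) (λ c → distributions-↭ L↭L′ _)
  distributions-↭ (↭.swap {L} {L′} x y L↭L′) β =
    trans (∑-comm (allFin k) (allFin k) (λ c d → distributions L (addAt (addAt β c x) d y)))
          (∑-cong (allFin k) λ d → ∑-cong (allFin k) λ c →
            trans (distributions-cong L (λ i → xy∙z≈xz∙y (β i) _ _)) (distributions-↭ L↭L′ _))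
  distributions-↭ (↭.trans L↭L′ L′↭L″) β = trans (distributions-↭ L↭L′ β) (distributions-↭ L′↭L″ β)

  MonomialFrom : ∀ {m} → (Fin m → ℕ) → (Fin k → ℕ) → Vec (Fin k) m → Set
  MonomialFrom W β κ = tabulate (λ i → β i + classWeight κ W i) ≡ α

  monomialFrom? : ∀ {m} (W : Fin m → ℕ) β κ → Dec (MonomialFrom W β κ)
  monomialFrom? W β κ = Vecₚ.≡-dec ℕ._≟_ _ α

  count-monomialFrom : ∀ m (W : Fin m → ℕ) β → count (monomialFrom? W β) (allVec k m) ≡ distributions (List.tabulate W) β
  count-monomialFrom zero W β =
    trans (count≡∑𝟙 (monomialFrom? W β) (allVec k 0)) (trans (ℕₚ.+-identityʳ (𝟙 (monomialFrom? W β [])))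
      (𝟙-cong (monomialFrom? W β []) (Vecₚ.≡-dec ℕ._≟_ (tabulate β) α)
              (trans (Vecₚ.tabulate-cong λ i → sym (ℕₚ.+-identityʳ (β i))))
              (trans (Vecₚ.tabulate-cong λ i → ℕₚ.+-identityʳ (β i)))))
  count-monomialFrom (suc m) W β = begin
    count (monomialFrom? W β) (allVec k (suc m))
      ≡⟨ count≡∑𝟙 (monomialFrom? W β) (allVec k (suc m)) ⟩
    ∑ (allVec k (suc m)) (𝟙 ∘ monomialFrom? W β)
      ≡⟨ ∑-concatMap _ (allFin k) _ ⟩
    ∑ (allFin k) (λ c → ∑ (map (c ∷_) (allVec k m)) (𝟙 ∘ monomialFrom? W β))
      ≡⟨ ∑-cong (allFin k) (λ c → trans (∑-map (c ∷_) (allVec k m) _) (∑-cong (allVec k m) λ κ →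
           𝟙-cong (monomialFrom? W β (c ∷ κ)) (monomialFrom? (W ∘ Fin.suc) (addAt β c (W Fin.zero)) κ)
                  (trans (Vecₚ.tabulate-cong (sym ∘ shift c κ))) (trans (Vecₚ.tabulate-cong (shift c κ))))) ⟩
    ∑ (allFin k) (λ c → ∑ (allVec k m) (𝟙 ∘ monomialFrom? (W ∘ Fin.suc) (addAt β c (W Fin.zero))))
      ≡⟨ ∑-cong (allFin k) (λ c → trans (sym (count≡∑𝟙 _ (allVec k m))) (count-monomialFrom m (W ∘ Fin.suc) _)) ⟩
    distributions (List.tabulate W) β ∎
    where
    open ≡-Reasoning
    shift : ∀ c κ i → β i + classWeight (c ∷ κ) W i ≡ addAt β c (W Fin.zero) i + classWeight κ (W ∘ Fin.suc) i
    shift c κ i = trans (cong (β i +_) (∑-allFin-suc (λ v → if ⌊ lookup (c ∷ κ) v Fin.≟ i ⌋ then W v else 0)))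
                          (sym (ℕₚ.+-assoc (β i) _ _))

  count-monomial≡pcoef : ∀ {m} (W : Fin m → ℕ) λs → λs ↭ List.tabulate W → count (hasMonomial? W α) (allVec k m) ≡ pcoef λs α
  count-monomial≡pcoef {m} W λs λs↭W = begin
    count (hasMonomial? W α) (allVec k m)                             ≡⟨ count-monomialFrom m W (λ _ → 0) ⟩
    distributions (List.tabulate W) (λ _ → 0)                          ≡⟨ distributions-↭ (↭-sym λs↭W) _ ⟩
    distributions λs (λ _ → 0)                                         ≡⟨ cong (λ L → distributions L (λ _ → 0)) (Listₚ.tabulate-lookup λs) ⟨
    distributions (List.tabulate (List.lookup λs)) (λ _ → 0)           ≡⟨ count-monomialFrom (length λs) (List.lookup λs) (λ _ → 0) ⟨
    pcoef λs α ∎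
    where open ≡-Reasoning

module SortDescending = Sort (DecTotalOrderₚ.≥-decTotalOrder ℕₚ.≤-decTotalOrder)

sum-tabulate : ∀ {m} (W : Fin m → ℕ) → sum (List.tabulate W) ≡ ∑ (allFin m) W
sum-tabulate W = cong sum (sym (Listₚ.map-tabulate id W))

classWeight-pullback : ∀ {n m k} (r : Fin n → Fin m) (w : Fin n → ℕ) (κ : Vec (Fin k) m) i →
  classWeight (tabulate (lookup κ ∘ r)) w i ≡ classWeight κ (push r w) i
classWeight-pullback {n} r w κ i = trans
  (∑-cong (allFin n) (λ v → cong (λ c → if ⌊ c Fin.≟ i ⌋ then w v else 0) (Vecₚ.lookup∘tabulate (lookup κ ∘ r) v)))
  (sym (push-∘ r w (lookup κ) i))

module ClassPartition {n : ℕ} (w : Fin n → ℕ) where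

  classWeights : (C : List (Fin n × Fin n)) → Fin (size C) → ℕ
  classWeights C = push (classOf C) w

  partitionOf : List (Fin n × Fin n) → List ℕ
  partitionOf C = SortDescending.sort (List.tabulate (classWeights C))

  partitionOf-↭ : ∀ C → partitionOf C ↭ List.tabulate (classWeights C)
  partitionOf-↭ C = SortDescending.sort-↭ (List.tabulate (classWeights C))

  length-partitionOf : ∀ C → length (partitionOf C) ≡ size C
  length-partitionOf C = trans (↭-length (partitionOf-↭ C)) (Listₚ.length-tabulate (classWeights C))

  sum-partitionOf : ∀ C → sum (partitionOf C) ≡ totalWeight w
  sum-partitionOf C = trans (sum-↭ (partitionOf-↭ C)) (trans (sum-tabulate (classWeights C)) (∑-push-total (classOf C) w))

  partitionOf-isPartition : PositiveWeight w → ∀ C → IsPartition (partitionOf C)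
  partitionOf-isPartition w-pos C =
    All-resp-↭ (↭-sym (partitionOf-↭ C)) (Allₚ.tabulate⁺ class-nonempty) , SortDescending.sort-↗ (List.tabulate (classWeights C))
    where
    class-nonempty : ∀ j → 1 ≤ classWeights C j
    class-nonempty j = begin
      1                                                               ≤⟨ w-pos (repOf C j) ⟩
      w (repOf C j)                                                   ≡⟨ cong (λ b → if b then w (repOf C j) else 0) rep∈class ⟨
      (if ⌊ classOf C (repOf C j) Fin.≟ j ⌋ then w (repOf C j) else 0) ≤⟨ term≤∑ (λ v → if ⌊ classOf C v Fin.≟ j ⌋ then w v else 0)
                                                                                (∈-allFin (repOf C j)) ⟩
      classWeights C j                                                ∎
      where
      open ℕₚ.≤-Reasoning
      rep∈class : ⌊ classOf C (repOf C j) Fin.≟ j ⌋ ≡ true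
      rep∈class = trans (isYes≗does (classOf C (repOf C j) Fin.≟ j)) (dec-true (classOf C (repOf C j) Fin.≟ j) (classOf-repOf C j))

  module _ {k : ℕ} (α : Vec ℕ k) where
    open Colourings w α
    open Distributions α using (count-monomial≡pcoef)

    admissibleCount≡pcoef : ∀ C → admissibleCount C ≡ pcoef (partitionOf C) α
    admissibleCount≡pcoef C = begin
      admissibleCount C                                          ≡⟨ count≡∑𝟙 (admissible? C) (allVec k n) ⟨
      count (admissible? C) (allVec k n)                         ≡⟨ count-bijection restrict extend restrict-resp extend-resp
                                                                      extend∘restrict restrict∘extend (admissible? C)
                                                                      (hasMonomial? (classWeights C) α)
                                                                      (allVec-enumerates k n) (allVec-enumerates k (size C)) ⟩
      count (hasMonomial? (classWeights C) α) (allVec k (size C)) ≡⟨ count-monomial≡pcoef (classWeights C) (partitionOf C)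
                                                                                           (partitionOf-↭ C) ⟩
      pcoef (partitionOf C) α ∎
      where
      open ≡-Reasoning
      restrict : Vec (Fin k) n → Vec (Fin k) (size C)
      restrict κ = tabulate (lookup κ ∘ repOf C)
      extend : Vec (Fin k) (size C) → Vec (Fin k) n
      extend κ′ = tabulate (lookup κ′ ∘ classOf C)
      extend-monomial : ∀ κ′ → HasMonomial w α (extend κ′) → HasMonomial (classWeights C) α κ′
      extend-monomial κ′ = trans (Vecₚ.tabulate-cong (sym ∘ classWeight-pullback (classOf C) w κ′))
      monomial-extend : ∀ κ′ → HasMonomial (classWeights C) α κ′ → HasMonomial w α (extend κ′)
      monomial-extend κ′ = trans (Vecₚ.tabulate-cong (classWeight-pullback (classOf C) w κ′))
      extend∘restrict : ∀ κ → Admissible C κ → extend (restrict κ) ≡ κ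
      extend∘restrict κ (κ-const , _) = trans
        (Vecₚ.tabulate-cong λ v → trans (Vecₚ.lookup∘tabulate (lookup κ ∘ repOf C) (classOf C v))
          (ConstantOn-Connected κ κ-const (classOf≡⇒Connected C (classOf-repOf C (classOf C v)))))
        (Vecₚ.tabulate∘lookup κ)
      restrict∘extend : ∀ κ′ → HasMonomial (classWeights C) α κ′ → restrict (extend κ′) ≡ κ′
      restrict∘extend κ′ _ = trans
        (Vecₚ.tabulate-cong λ j → trans (Vecₚ.lookup∘tabulate (lookup κ′ ∘ classOf C) (repOf C j))
                                        (cong (lookup κ′) (classOf-repOf C j)))
        (Vecₚ.tabulate∘lookup κ′)
      restrict-resp : ∀ κ → Admissible C κ → HasMonomial (classWeights C) α (restrict κ)
      restrict-resp κ adm@(_ , mono) =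
        extend-monomial (restrict κ) (subst (HasMonomial w α) (sym (extend∘restrict κ adm)) mono)
      extend-resp : ∀ κ′ → HasMonomial (classWeights C) α κ′ → Admissible C (extend κ′)
      extend-resp κ′ mono = All.tabulate (λ {(u , v)} uv∈C →
          trans (Vecₚ.lookup∘tabulate (lookup κ′ ∘ classOf C) u)
                (trans (cong (lookup κ′) (classOf-link C uv∈C)) (sym (Vecₚ.lookup∘tabulate (lookup κ′ ∘ classOf C) v))))
        , monomial-extend κ′ mono

-- Signs and rational coefficients

ℕtoℚ-+ : ∀ a b → ℕtoℚ (a ℕ.+ b) ≡ ℕtoℚ a ℚ.+ ℕtoℚ b
ℕtoℚ-+ a b = ℚₚ.toℚᵘ-injective (begin
  ℚ.toℚᵘ (ℕtoℚ (a ℕ.+ b))                         ≈⟨ ℚₚ.toℚᵘ-fromℚᵘ (ℚᵘ.mkℚᵘ (+ (a ℕ.+ b)) 0) ⟩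
  ℚᵘ.mkℚᵘ (+ (a ℕ.+ b)) 0                         ≈⟨ ℚᵘ.*≡* (trans (cong (ℤ._* (+ 1 ℤ.* + 1)) (ℤₚ.pos-+ a b))
                                                               (ℤ-solve 2 (λ x y → (x :+ y) :* (con (+ 1) :* con (+ 1))
                                                                                  := (x :* con (+ 1) :+ y :* con (+ 1)) :* con (+ 1))
                                                                          refl (+ a) (+ b))) ⟩
  ℚᵘ.mkℚᵘ (+ a) 0 ℚᵘ.+ ℚᵘ.mkℚᵘ (+ b) 0            ≈⟨ ℚᵘₚ.+-cong (ℚₚ.toℚᵘ-fromℚᵘ (ℚᵘ.mkℚᵘ (+ a) 0))
                                                                (ℚₚ.toℚᵘ-fromℚᵘ (ℚᵘ.mkℚᵘ (+ b) 0)) ⟨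
  ℚ.toℚᵘ (ℕtoℚ a) ℚᵘ.+ ℚ.toℚᵘ (ℕtoℚ b)            ≈⟨ ℚₚ.toℚᵘ-homo-+ (ℕtoℚ a) (ℕtoℚ b) ⟨
  ℚ.toℚᵘ (ℕtoℚ a ℚ.+ ℕtoℚ b) ∎)
  where
  open ℤ using (+_)
  open ℚᵘₚ.≃-Reasoning
  open ℤ-Solver renaming (solve to ℤ-solve)

signℚ-suc : ∀ e → signℚ (suc e) ≡ ℚ.- signℚ e
signℚ-suc zero    = refl
signℚ-suc (suc e) = sym (trans (cong ℚ.-_ (signℚ-suc e)) (⁻¹-involutive (signℚ e)))

signℚ-+ : ∀ a b → signℚ (a ℕ.+ b) ≡ signℚ a ℚ.* signℚ b
signℚ-+ zero    b = sym (ℚₚ.*-identityˡ (signℚ b))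
signℚ-+ (suc a) b = begin
  signℚ (suc a ℕ.+ b)           ≡⟨ signℚ-suc (a ℕ.+ b) ⟩
  ℚ.- signℚ (a ℕ.+ b)           ≡⟨ cong ℚ.-_ (signℚ-+ a b) ⟩
  ℚ.- (signℚ a ℚ.* signℚ b)     ≡⟨ ℚₚ.neg-distribˡ-* (signℚ a) (signℚ b) ⟩
  ℚ.- signℚ a ℚ.* signℚ b       ≡⟨ cong (ℚ._* signℚ b) (signℚ-suc a) ⟨
  signℚ (suc a) ℚ.* signℚ b     ∎
  where open ≡-Reasoning

signℚ-square : ∀ a → signℚ a ℚ.* signℚ a ≡ 1ℚ
signℚ-square zero    = refl
signℚ-square (suc a) = begin
  signℚ (suc a) ℚ.* signℚ (suc a)   ≡⟨ cong₂ ℚ._*_ (signℚ-suc a) (signℚ-suc a) ⟩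
  ℚ.- signℚ a ℚ.* ℚ.- signℚ a       ≡⟨ solve 1 (λ x → (:- x) :* (:- x) := x :* x) refl (signℚ a) ⟩
  signℚ a ℚ.* signℚ a               ≡⟨ signℚ-square a ⟩
  1ℚ                                 ∎
  where
  open ≡-Reasoning
  open +-*-Solver

evalCoef-++ : ∀ {k} (L L′ : PExpansion) (α : Vec ℕ k) → evalCoef (L ++ L′) α ≡ evalCoef L α ℚ.+ evalCoef L′ α
evalCoef-++ []             L′ α = sym (ℚₚ.+-identityˡ (evalCoef L′ α))
evalCoef-++ ((λs , c) ∷ L) L′ α =
  trans (cong (c ℚ.* ℕtoℚ (pcoef λs α) ℚ.+_) (evalCoef-++ L L′ α))
        (sym (ℚₚ.+-assoc (c ℚ.* ℕtoℚ (pcoef λs α)) (evalCoef L α) (evalCoef L′ α)))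

-- The expansion

module Expansion {n : ℕ} (w : Fin n → ℕ) where
  open ClassPartition w

  mutual
    contractions : (E C : List (Fin n × Fin n)) → List (List (Fin n × Fin n))
    contractions []            C = C ∷ []
    contractions ((a , b) ∷ E) C = branch E C a b (classOf C a Fin.≟ classOf C b)

    branch : ∀ E C a b → Dec (classOf C a ≡ classOf C b) → List (List (Fin n × Fin n))
    branch E C a b (yes _) = []
    branch E C a b (no _)  = contractions E C ++ contractions E ((a , b) ∷ C)

  sign : List (Fin n × Fin n) → ℚ
  sign C = signℚ (n ∸ size C)

  term : List (Fin n × Fin n) → List ℕ × ℚ
  term C = partitionOf C , sign C

  expansion : (E C : List (Fin n × Fin n)) → PExpansion
  expansion E C = map term (contractions E C)

  signedω : PExpansion → PExpansion
  signedω L = scaleExp (signℚ (totalWeight w ∸ n)) (ωExp L)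

  sign-contract : ∀ C a b → classOf C a ≢ classOf C b → sign ((a , b) ∷ C) ≡ ℚ.- sign C
  sign-contract C a b differ = begin
    signℚ (n ∸ m′)             ≡⟨ cong signℚ (ℕₚ.+-∸-assoc 1 m′<n) ⟩
    signℚ (suc (n ∸ suc m′))   ≡⟨ cong (λ m → signℚ (suc (n ∸ m))) (size-contract C a b differ) ⟩
    signℚ (suc (n ∸ size C))   ≡⟨ signℚ-suc (n ∸ size C) ⟩
    ℚ.- sign C                 ∎
    where
    open ≡-Reasoning
    m′ : ℕ
    m′ = size ((a , b) ∷ C)
    m′<n : suc m′ ≤ n
    m′<n = subst (_≤ n) (sym (size-contract C a b differ)) (size≤n C)

  n≤totalWeight : PositiveWeight w → n ≤ totalWeight w
  n≤totalWeight w-pos = subst (_≤ totalWeight w) (trans (∑-one (allFin n)) (Listₚ.length-tabulate (λ v → v)))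
                              (∑-mono-≤ (allFin n) w-pos)

  signedωCoefficient : List (Fin n × Fin n) → ℚ
  signedωCoefficient C = signℚ (totalWeight w ∸ n) ℚ.* (signℚ (sum (partitionOf C) ∸ length (partitionOf C)) ℚ.* sign C)

  signedωCoefficient≡1 : PositiveWeight w → ∀ C → signedωCoefficient C ≡ 1ℚ
  signedωCoefficient≡1 w-pos C = begin
    s ℚ.* (signℚ (sum (partitionOf C) ∸ length (partitionOf C)) ℚ.* σ)
      ≡⟨ cong (λ e → s ℚ.* (signℚ e ℚ.* σ)) (cong₂ _∸_ (sum-partitionOf C) (length-partitionOf C)) ⟩
    s ℚ.* (signℚ (totalWeight w ∸ size C) ℚ.* σ)
      ≡⟨ cong (λ e → s ℚ.* (signℚ e ℚ.* σ)) d∸m≡ ⟩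
    s ℚ.* (signℚ ((totalWeight w ∸ n) + (n ∸ size C)) ℚ.* σ)
      ≡⟨ cong (λ x → s ℚ.* (x ℚ.* σ)) (signℚ-+ (totalWeight w ∸ n) (n ∸ size C)) ⟩
    s ℚ.* ((s ℚ.* σ) ℚ.* σ)
      ≡⟨ solve 2 (λ x y → x :* ((x :* y) :* y) := (x :* x) :* (y :* y)) refl s σ ⟩
    (s ℚ.* s) ℚ.* (σ ℚ.* σ)
      ≡⟨ cong₂ ℚ._*_ (signℚ-square (totalWeight w ∸ n)) (signℚ-square (n ∸ size C)) ⟩
    1ℚ ∎
    where
    open ≡-Reasoning
    open +-*-Solver
    s σ : ℚ
    s = signℚ (totalWeight w ∸ n)
    σ = sign C
    d∸m≡ : totalWeight w ∸ size C ≡ (totalWeight w ∸ n) + (n ∸ size C)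
    d∸m≡ = trans (cong (_∸ size C) (sym (ℕₚ.m∸n+n≡m (n≤totalWeight w-pos))))
                 (ℕₚ.+-∸-assoc (totalWeight w ∸ n) (size≤n C))

  signedω-positive : PositiveWeight w → ∀ Cs → PPositive (signedω (map term Cs))
  signedω-positive w-pos Cs = Allₚ.map⁺ (Allₚ.map⁺ (Allₚ.map⁺ (All.universal
    (λ C → subst (0ℚ ℚ.≤_) (sym (signedωCoefficient≡1 w-pos C)) (ℚₚ.nonNegative⁻¹ 1ℚ)) Cs)))

  sign-[] : sign [] ≡ 1ℚ
  sign-[] = cong signℚ (ℕₚ.n∸n≡0 n)

  module _ {k : ℕ} (α : Vec ℕ k) where
    open Colourings w α

    properCount-expansion : ∀ E C → sign C ℚ.* ℕtoℚ (properCount E C) ≡ evalCoef (expansion E C) α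
    properCount-expansion [] C = begin
      sign C ℚ.* ℕtoℚ (properCount [] C)                  ≡⟨ cong (λ x → sign C ℚ.* ℕtoℚ x)
                                                                 (trans (properCount-[] C) (admissibleCount≡pcoef α C)) ⟩
      sign C ℚ.* ℕtoℚ (pcoef (partitionOf C) α)           ≡⟨ ℚₚ.+-identityʳ (sign C ℚ.* ℕtoℚ (pcoef (partitionOf C) α)) ⟨
      sign C ℚ.* ℕtoℚ (pcoef (partitionOf C) α) ℚ.+ 0ℚ    ∎
      where open ≡-Reasoning
    properCount-expansion ((a , b) ∷ E) C = byBranch (classOf C a Fin.≟ classOf C b)
      where
      open ≡-Reasoning
      byBranch : (d : Dec (classOf C a ≡ classOf C b)) →
        sign C ℚ.* ℕtoℚ (properCount ((a , b) ∷ E) C) ≡ evalCoef (map term (branch E C a b d)) α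
      byBranch (yes same) = trans (cong (λ x → sign C ℚ.* ℕtoℚ x) (properCount-connected E C (classOf≡⇒Connected C same)))
                                  (ℚₚ.*-zeroʳ (sign C))
      byBranch (no differ) = begin
        σ ℚ.* X                                 ≡⟨ solve 3 (λ s x y → s :* x := s :* (x :+ y) :+ (:- s) :* y) refl σ X Y ⟩
        σ ℚ.* (X ℚ.+ Y) ℚ.+ (ℚ.- σ) ℚ.* Y        ≡⟨ cong₂ (λ z s′ → σ ℚ.* z ℚ.+ s′ ℚ.* Y)
                                                         (trans (sym (ℕtoℚ-+ (properCount ((a , b) ∷ E) C) (properCount E ((a , b) ∷ C))))
                                                                (cong ℕtoℚ (sym (properCount-deleteContract a b E C))))
                                                         (sym (sign-contract C a b differ)) ⟩
        σ ℚ.* ℕtoℚ (properCount E C) ℚ.+ sign ((a , b) ∷ C) ℚ.* Y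
                                                  ≡⟨ cong₂ ℚ._+_ (properCount-expansion E C) (properCount-expansion E ((a , b) ∷ C)) ⟩
        evalCoef (expansion E C) α ℚ.+ evalCoef (expansion E ((a , b) ∷ C)) α
                                                  ≡⟨ evalCoef-++ (expansion E C) (expansion E ((a , b) ∷ C)) α ⟨
        evalCoef (expansion E C ++ expansion E ((a , b) ∷ C)) α
                                                  ≡⟨ cong (λ L → evalCoef L α)
                                                          (Listₚ.map-++ term (contractions E C) (contractions E ((a , b) ∷ C))) ⟨
        evalCoef (map term (contractions E C ++ contractions E ((a , b) ∷ C))) α ∎
        where
        open +-*-Solver
        σ X Y : ℚ
        σ = sign C
        X = ℕtoℚ (properCount ((a , b) ∷ E) C)
        Y = ℕtoℚ (properCount E ((a , b) ∷ C))

    pairCount-contractions : ∀ E C → pairCount E C ≡ ∑ (contractions E C) admissibleCount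
    pairCount-contractions [] C = trans (pairCount-[] C) (sym (ℕₚ.+-identityʳ (admissibleCount C)))
    pairCount-contractions ((a , b) ∷ E) C = byBranch (classOf C a Fin.≟ classOf C b)
      where
      byBranch : (d : Dec (classOf C a ≡ classOf C b)) → pairCount ((a , b) ∷ E) C ≡ ∑ (branch E C a b d) admissibleCount
      byBranch (yes same)  = pairCount-connected E C (classOf≡⇒Connected C same)
      byBranch (no differ) = trans (pairCount-deleteContract a b E C (differ ∘ Connected⇒classOf≡ C))
        (trans (cong₂ _+_ (pairCount-contractions E C) (pairCount-contractions E ((a , b) ∷ C)))
               (sym (∑-++ (contractions E C) (contractions E ((a , b) ∷ C)) admissibleCount)))

    evalCoef-signedω : PositiveWeight w → ∀ Cs →
      evalCoef (signedω (map term Cs)) α ≡ ℕtoℚ (∑ Cs admissibleCount)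
    evalCoef-signedω w-pos []       = refl
    evalCoef-signedω w-pos (C ∷ Cs) = begin
      signedωCoefficient C ℚ.* ℕtoℚ (pcoef (partitionOf C) α) ℚ.+ evalCoef (signedω (map term Cs)) α
        ≡⟨ cong₂ ℚ._+_ (trans (cong (ℚ._* ℕtoℚ (pcoef (partitionOf C) α)) (signedωCoefficient≡1 w-pos C))
                              (ℚₚ.*-identityˡ (ℕtoℚ (pcoef (partitionOf C) α))))
                       (evalCoef-signedω w-pos Cs) ⟩
      ℕtoℚ (pcoef (partitionOf C) α) ℚ.+ ℕtoℚ (∑ Cs admissibleCount)
        ≡⟨ cong (λ p → ℕtoℚ p ℚ.+ ℕtoℚ (∑ Cs admissibleCount)) (admissibleCount≡pcoef α C) ⟨
      ℕtoℚ (admissibleCount C) ℚ.+ ℕtoℚ (∑ Cs admissibleCount)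
        ≡⟨ ℕtoℚ-+ (admissibleCount C) (∑ Cs admissibleCount) ⟨
      ℕtoℚ (∑ (C ∷ Cs) admissibleCount) ∎
      where open ≡-Reasoning

    module _ (G : Graph n) where

      Xcoef-expansion : ℕtoℚ (Xcoef G w α) ≡ evalCoef (expansion (edges G) []) α
      Xcoef-expansion = begin
        ℕtoℚ (Xcoef G w α)                              ≡⟨ cong ℕtoℚ (Xcoef≡properCount G w α) ⟩
        ℕtoℚ (properCount (edges G) [])                 ≡⟨ ℚₚ.*-identityˡ (ℕtoℚ (properCount (edges G) [])) ⟨
        1ℚ ℚ.* ℕtoℚ (properCount (edges G) [])          ≡⟨ cong (ℚ._* ℕtoℚ (properCount (edges G) [])) sign-[] ⟨
        sign [] ℚ.* ℕtoℚ (properCount (edges G) [])     ≡⟨ properCount-expansion (edges G) [] ⟩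
        evalCoef (expansion (edges G) []) α             ∎
        where open ≡-Reasoning

      XbarPair-expansion : PositiveWeight w → ∀ {m} → CountIs (XbarPair G w α) m →
        ℕtoℚ m ≡ evalCoef (signedω (expansion (edges G) [])) α
      XbarPair-expansion w-pos {m} counted = begin
        ℕtoℚ m                                                ≡⟨ cong ℕtoℚ (CountIs-XbarPair G w α counted) ⟩
        ℕtoℚ (pairCount (edges G) [])                         ≡⟨ cong ℕtoℚ (pairCount-contractions (edges G) []) ⟩
        ℕtoℚ (∑ (contractions (edges G) []) admissibleCount)  ≡⟨ evalCoef-signedω w-pos (contractions (edges G) []) ⟨
        evalCoef (signedω (expansion (edges G) [])) α         ∎
        where open ≡-Reasoning

corollary1 : ∀ {n : ℕ} (G : Graph n) (w : Fin n → ℕ) → PositiveWeight w →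
    Σ PExpansion λ LX →
      ValidPExpansion LX
      × (∀ {k : ℕ} (α : Vec ℕ k) → ℕtoℚ (Xcoef G w α) ≡ evalCoef LX α)
      × (∀ {k : ℕ} (α : Vec ℕ k) (m : ℕ) → CountIs (XbarPair G w α) m →
           ℕtoℚ m ≡ evalCoef (scaleExp (signℚ (totalWeight w Data.Nat.∸ n)) (ωExp LX)) α)
      × PPositive (scaleExp (signℚ (totalWeight w Data.Nat.∸ n)) (ωExp LX))
corollary1 G w w-pos =
  expansion (edges G) [] ,
  Allₚ.map⁺ (All.universal (partitionOf-isPartition w-pos) (contractions (edges G) [])) ,
  (λ α → Xcoef-expansion α G) ,
  (λ α m → XbarPair-expansion α G w-pos) ,
  signedω-positive w-pos (contractions (edges G) [])
  where
  open Expansion w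
  open ClassPartition w
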